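{- Let $S,T$ be disjoint finite sets, $\mu$ a probability measure on $\{0,1\}^S$ and $\nu$ a probability measure on $\{0,1\}^T$, and let $\mu\times\nu$ be the product measure on $\{0,1\}^{S\cup T}$, $\mu\times\nu(\xi,\eta)=\mu(\xi)\nu(\eta)$. (a) If $\mu$ and $\nu$ are APU, then $\mu\times\nu$ is APU. (b) If $\mu$ and $\nu$ are CAPU, then $\mu\times\nu$ is CAPU.
   Context: Write $|\eta|=\sum\eta_i$, $\mathbf{1}=(1,\dots,1)$. For a probability measure $\rho$ on $\{0,1\}^U$ with $|U|=m$, $\gamma_i(\rho)=\binom{m}{i}^{ -1}\sum\{\rho(\eta)\rho(\mathbf{1}-\eta):\eta\in\{0,1\}^U,|\eta|=i\}$. A sequence $(c_0,\dots,c_m)$ is unimodal if there is $k$ with $c_0\le\cdots\le c_k\ge\cdots\ge c_m$. $\rho$ is antipodal pairs unimodal (APU) if $(\gamma_i(\rho))_{i=0}^m$ is unimodal. Conditioning $\rho$ means passing to $\rho(\cdot\mid\eta_i=\xi_i\ \forall i\in I)$ for some $I\subseteq U$, $\xi\in\{0,1\}^I$ with positive probability, regarded as a measure on $\{0,1\}^{U\setminus I}$; $\rho$ is CAPU if every measure obtained from $\rho$ by conditioning is APU. -}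

module Defs where

open import Level using (0ℓ)
open import Data.Bool using (Bool; true; false; not)
open import Data.Nat as ℕ using (ℕ; zero; suc)
open import Data.Nat.Combinatorics using (_C_)
open import Data.Maybe using (Maybe; just; nothing)
open import Data.List using (List; []; _∷_; _++_; map; filter; foldr)
open import Data.Vec using (Vec; []; _∷_; take; drop) renaming (map to vmap)
open import Data.Product using (Σ; ∃; ∃-syntax; _×_; _,_)
open import Relation.Binary.PropositionalEquality using (_≡_; _≢_)
open import Relation.Binary.Structures using (IsTotalOrder)
open import Algebra.Structures using (IsCommutativeRing)
open import Relation.Nullary using (¬_)
open import Relation.Nullary.Decidable using (⌊_⌋)

-- An ordered field (with equality being propositional equality).
-- The inverse is a total operation, specified only on nonzero elements.
record OrderedField : Set₁ where
  infixl 6 _+_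
  infixl 7 _*_
  infix 4 _≤_
  field
    Carrier : Set
    _+_ _*_ : Carrier → Carrier → Carrier
    -_ : Carrier → Carrier
    0# 1# : Carrier
    isCommutativeRing : IsCommutativeRing _≡_ _+_ _*_ -_ 0# 1#
    _⁻¹ : Carrier → Carrier
    ⁻¹-inverse : ∀ x → x ≢ 0# → x * (x ⁻¹) ≡ 1#
    0≢1 : 0# ≢ 1#
    _≤_ : Carrier → Carrier → Set
    isTotalOrder : IsTotalOrder _≡_ _≤_
    +-monoˡ-≤ : ∀ x y z → x ≤ y → x + z ≤ y + z
    *-nonneg : ∀ x y → 0# ≤ x → 0# ≤ y → 0# ≤ x * y

  _<_ : Carrier → Carrier → Set
  x < y = x ≤ y × x ≢ y

-- all configurations {0,1}^m, as vectors of booleans (true = 1)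
allVecs : (m : ℕ) → List (Vec Bool m)
allVecs zero = [] ∷ []
allVecs (suc m) = map (true ∷_) (allVecs m) ++ map (false ∷_) (allVecs m)

weight : ∀ {m} → Vec Bool m → ℕ
weight [] = 0
weight (true ∷ η) = suc (weight η)
weight (false ∷ η) = weight η

flipAll : ∀ {m} → Vec Bool m → Vec Bool m
flipAll = vmap not

-- a partial assignment: just b = coordinate fixed to b, nothing = free
free : ∀ {m} → Vec (Maybe Bool) m → ℕ
free [] = 0
free (nothing ∷ p) = suc (free p)
free (just _ ∷ p) = free p

fill : ∀ {m} (p : Vec (Maybe Bool) m) → Vec Bool (free p) → Vec Bool m
fill [] [] = []
fill (nothing ∷ p) (b ∷ η) = b ∷ fill p η
fill (just b ∷ p) η = b ∷ fill p η

module _ (F : OrderedField) where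
  open OrderedField F

  Measure : ℕ → Set
  Measure m = Vec Bool m → Carrier

  sumL : ∀ {A : Set} → (A → Carrier) → List A → Carrier
  sumL f = foldr (λ a s → f a + s) 0#

  total : ∀ {m} → Measure m → Carrier
  total {m} ρ = sumL ρ (allVecs m)

  IsProbability : ∀ {m} → Measure m → Set
  IsProbability ρ = (∀ η → 0# ≤ ρ η) × total ρ ≡ 1#

  fromℕ : ℕ → Carrier
  fromℕ zero = 0#
  fromℕ (suc k) = 1# + fromℕ k

  γ : ∀ {m} → Measure m → ℕ → Carrier
  γ {m} ρ i =
    (fromℕ (m C i)) ⁻¹ *
      sumL (λ η → ρ η * ρ (flipAll η))
           (filter (λ η → weight η ℕ.≟ i) (allVecs m))

  Unimodal : ℕ → (ℕ → Carrier) → Set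
  Unimodal m c = ∃[ k ] (k ℕ.≤ m
    × (∀ i → i ℕ.< k → c i ≤ c (suc i))
    × (∀ i → k ℕ.≤ i → i ℕ.< m → c (suc i) ≤ c i))

  APU : ∀ {m} → Measure m → Set
  APU {m} ρ = Unimodal m (γ ρ)

  pinnedMass : ∀ {m} → Measure m → Vec (Maybe Bool) m → Carrier
  pinnedMass ρ p = sumL (λ η → ρ (fill p η)) (allVecs (free p))

  condition : ∀ {m} → Measure m → (p : Vec (Maybe Bool) m) → Measure (free p)
  condition ρ p η = ρ (fill p η) * (pinnedMass ρ p) ⁻¹

  CAPU : ∀ {m} → Measure m → Set
  CAPU {m} ρ = ∀ (p : Vec (Maybe Bool) m) → 0# < pinnedMass ρ p
    → APU (condition ρ p)

  -- product measure on {0,1}^{S ∪ T}, S = first m coordinates, T = last n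
  _⊗_ : ∀ {m n} → Measure m → Measure n → Measure (m ℕ.+ n)
  _⊗_ {m} μ ν ζ = μ (take m ζ) * ν (drop m ζ)

-- γ(ρ) is symmetric, γ_i = γ_{N−i}, so it is unimodal exactly when it rises up to the
-- middle: γ_k ≤ γ_{k+1} whenever 2k < N. In terms of the antipodal masses A_k = C(N,k) γ_k
-- this reads (N − k) A_k ≤ (k + 1) A_{k+1}. For a product measure, A(μ × ν) is the
-- convolution of a = A(μ) and b = A(ν): the coefficients of the product PQ of
-- P = Σ C(m,i) α_i xⁱ and Q = Σ C(n,j) β_j xʲ, where α = γ(μ), β = γ(ν). The Leibniz rule,
-- applied to (PQ)′ and to (m + n) PQ − x (PQ)′, shows that the two sides differ by
-- m · Σ_i C(m−1,i) (α_{i+1} − α_i) b_{k−i} plus the same term with μ and ν exchanged.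
-- Pairing i with m − 1 − i, the differences of α change sign while b_{k−i} decreases
-- (b is symmetric and rises to its middle), so each such sum is nonnegative.
-- Conditioning μ × ν on a pattern gives the product of the conditioned factors on the
-- free coordinates, so the CAPU case reduces to the APU case.

module Submission where

open import Defs
open import Data.Bool using (Bool; true; false; not)
open import Data.Nat as ℕ using (ℕ; zero; suc; z≤n; s≤s; _∸_; ⌊_/2⌋)
import Data.Nat.Properties as ℕ
open import Data.Nat.Combinatorics using (_C_; nCk≡nC[n∸k])
open import Data.Nat.Combinatorics.Specification using (k>n⇒nCk≡0)
open import Algebra.Properties.CommutativeSemigroup ℕ.+-commutativeSemigroup using () renaming (interchange to +-interchange)
open import Data.Integer as ℤ using (ℤ; -[1+_]) renaming (+_ to +ℤ)
import Data.Integer.Properties as ℤ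
import Data.Sign as Sign
open import Data.List as List using (List; []; _∷_; filter)
open import Data.Vec using (Vec; []; _∷_; _++_; take; drop)
open import Data.Vec.Properties using (map-++)
open import Data.Maybe using (Maybe; just; nothing)
open import Data.Product using (_×_; _,_)
open import Data.Sum using (inj₁; inj₂)
open import Data.Empty using (⊥-elim)
open import Function using (_∘_)
open import Relation.Nullary using (Dec; yes; no; contradiction)
open import Relation.Unary using (Pred; Decidable)
open import Relation.Binary.PropositionalEquality
open import Relation.Binary.Structures using (IsTotalOrder)
open import Relation.Binary.Bundles using (Poset)
import Relation.Binary.Reasoning.PartialOrder as PosetReasoning
open import Algebra.Bundles using (CommutativeRing)
open import Algebra.Solver.Ring.AlmostCommutativeRing using (fromCommutativeRing; _-Raw-AlmostCommutative⟶_)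

module BinomialCoefficients where

  open import Data.Nat
  open import Data.Nat.Properties
  open import Data.Nat.Combinatorics using (nCk+nC[k+1]≡[n+1]C[k+1]; nC1≡n)
  open import Data.Nat.Tactic.RingSolver using (solve-∀)

  [k+1]*[n+1]C[k+1]≡[n+1]*nCk : ∀ n k → suc k * (suc n C suc k) ≡ suc n * (n C k)
  [k+1]*[n+1]C[k+1]≡[n+1]*nCk zero zero = refl
  [k+1]*[n+1]C[k+1]≡[n+1]*nCk zero (suc k) = *-zeroʳ (suc (suc k))
  [k+1]*[n+1]C[k+1]≡[n+1]*nCk (suc n) zero =
    trans (*-identityˡ _) (trans (nC1≡n (suc (suc n))) (sym (*-identityʳ _)))
  [k+1]*[n+1]C[k+1]≡[n+1]*nCk (suc n) (suc k) = begin
      suc (suc k) * (suc (suc n) C suc (suc k))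
    ≡⟨ cong (suc (suc k) *_) (sym (nCk+nC[k+1]≡[n+1]C[k+1] (suc n) (suc k))) ⟩
      suc (suc k) * (A + B)
    ≡⟨ rearrange k A B ⟩
      suc k * A + suc (suc k) * B + A
    ≡⟨ cong₂ (λ x y → x + y + A) ([k+1]*[n+1]C[k+1]≡[n+1]*nCk n k) ([k+1]*[n+1]C[k+1]≡[n+1]*nCk n (suc k)) ⟩
      suc n * (n C k) + suc n * (n C suc k) + A
    ≡⟨ cong (_+ A) (sym (*-distribˡ-+ (suc n) (n C k) (n C suc k))) ⟩
      suc n * (n C k + n C suc k) + A
    ≡⟨ cong (λ x → suc n * x + A) (nCk+nC[k+1]≡[n+1]C[k+1] n k) ⟩
      suc n * A + A
    ≡⟨ +-comm (suc n * A) A ⟩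
      suc (suc n) * A ∎
    where
      open ≡-Reasoning
      A = suc n C suc k
      B = suc n C suc (suc k)
      rearrange : ∀ k A B → suc (suc k) * (A + B) ≡ suc k * A + suc (suc k) * B + A
      rearrange = solve-∀

  [n+1∸k]*[n+1]Ck≡[n+1]*nCk : ∀ n k → (suc n ∸ k) * (suc n C k) ≡ suc n * (n C k)
  [n+1∸k]*[n+1]Ck≡[n+1]*nCk n k with k ≤? n
  ... | yes k≤n = begin
      (suc n ∸ k) * (suc n C k)
    ≡⟨ cong ((suc n ∸ k) *_) (nCk≡nC[n∸k] (m≤n⇒m≤1+n k≤n)) ⟩
      (suc n ∸ k) * (suc n C (suc n ∸ k))
    ≡⟨ cong (λ j → j * (suc n C j)) (+-∸-assoc 1 k≤n) ⟩
      suc (n ∸ k) * (suc n C suc (n ∸ k))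
    ≡⟨ [k+1]*[n+1]C[k+1]≡[n+1]*nCk n (n ∸ k) ⟩
      suc n * (n C (n ∸ k))
    ≡⟨ cong (suc n *_) (sym (nCk≡nC[n∸k] k≤n)) ⟩
      suc n * (n C k) ∎
    where open ≡-Reasoning
  ... | no k≰n = begin
      (suc n ∸ k) * (suc n C k)
    ≡⟨ cong (_* (suc n C k)) (m≤n⇒m∸n≡0 (≰⇒> k≰n)) ⟩
      0
    ≡⟨ sym (*-zeroʳ (suc n)) ⟩
      suc n * 0
    ≡⟨ cong (suc n *_) (sym (k>n⇒nCk≡0 (≰⇒> k≰n))) ⟩
      suc n * (n C k) ∎
    where open ≡-Reasoning

  [k+1]*nC[k+1]≡[n∸k]*nCk : ∀ n k → suc k * (n C suc k) ≡ (n ∸ k) * (n C k)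
  [k+1]*nC[k+1]≡[n∸k]*nCk zero zero = refl
  [k+1]*nC[k+1]≡[n∸k]*nCk zero (suc k) = *-zeroʳ (suc (suc k))
  [k+1]*nC[k+1]≡[n∸k]*nCk (suc n) k =
    trans ([k+1]*[n+1]C[k+1]≡[n+1]*nCk n k) (sym ([n+1∸k]*[n+1]Ck≡[n+1]*nCk n k))

  k≤n⇒0<nCk : ∀ {n k} → k ≤ n → 0 < n C k
  k≤n⇒0<nCk {n} {zero} _ = s≤s z≤n
  k≤n⇒0<nCk {suc n} {suc k} (s≤s k≤n) = begin-strict
    0                      <⟨ k≤n⇒0<nCk k≤n ⟩
    n C k                  ≤⟨ m≤m+n (n C k) (n C suc k) ⟩
    n C k + n C suc k      ≡⟨ nCk+nC[k+1]≡[n+1]C[k+1] n k ⟩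
    suc n C suc k          ∎
    where open ≤-Reasoning

  k+k<n⇒nCk≤nC[k+1] : ∀ {n k} → suc (k + k) ≤ n → n C k ≤ n C suc k
  k+k<n⇒nCk≤nC[k+1] {n} {k} k+k<n = *-cancelˡ-≤ (suc k) (begin
    suc k * (n C k)         ≤⟨ *-monoˡ-≤ (n C k) (m+n≤o⇒m≤o∸n (suc k) k+k<n) ⟩
    (n ∸ k) * (n C k)       ≡⟨ [k+1]*nC[k+1]≡[n∸k]*nCk n k ⟨
    suc k * (n C suc k)     ∎)
    where open ≤-Reasoning

open BinomialCoefficients

-- Index arithmetic

⌊n/2⌋+⌊n/2⌋≤n : ∀ n → ⌊ n /2⌋ ℕ.+ ⌊ n /2⌋ ℕ.≤ n
⌊n/2⌋+⌊n/2⌋≤n zero = z≤n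
⌊n/2⌋+⌊n/2⌋≤n (suc zero) = z≤n
⌊n/2⌋+⌊n/2⌋≤n (suc (suc n)) = s≤s (ℕ.≤-trans (ℕ.≤-reflexive (ℕ.+-suc h h)) (s≤s (⌊n/2⌋+⌊n/2⌋≤n n)))
  where h = ⌊ n /2⌋

n≤1+⌊n/2⌋+⌊n/2⌋ : ∀ n → n ℕ.≤ suc (⌊ n /2⌋ ℕ.+ ⌊ n /2⌋)
n≤1+⌊n/2⌋+⌊n/2⌋ zero = z≤n
n≤1+⌊n/2⌋+⌊n/2⌋ (suc zero) = s≤s z≤n
n≤1+⌊n/2⌋+⌊n/2⌋ (suc (suc n)) = s≤s (ℕ.≤-trans (s≤s (n≤1+⌊n/2⌋+⌊n/2⌋ n)) (ℕ.≤-reflexive (sym (ℕ.+-suc (suc h) h))))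
  where h = ⌊ n /2⌋

1+i+i≤m⇒i≤m∸[1+i] : ∀ {m i} → suc (i ℕ.+ i) ℕ.≤ m → i ℕ.≤ m ∸ suc i
1+i+i≤m⇒i≤m∸[1+i] {m} {i} 1+i+i≤m = ℕ.m+n≤o⇒m≤o∸n i (subst (ℕ._≤ m) (sym (ℕ.+-suc i i)) 1+i+i≤m)

m∸[1+i]≤i⇒1+[m∸[1+i]]+[m∸[1+i]]≤m : ∀ {m i} → suc i ℕ.≤ m → m ∸ suc i ℕ.≤ i →
  suc ((m ∸ suc i) ℕ.+ (m ∸ suc i)) ℕ.≤ m
m∸[1+i]≤i⇒1+[m∸[1+i]]+[m∸[1+i]]≤m {m} {i} 1+i≤m t≤i = begin
  suc (t ℕ.+ t)   ≤⟨ s≤s (ℕ.+-monoʳ-≤ t t≤i) ⟩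
  suc (t ℕ.+ i)   ≡⟨ ℕ.+-suc t i ⟨
  t ℕ.+ suc i     ≡⟨ ℕ.m∸n+n≡m 1+i≤m ⟩
  m               ∎
  where
  open ℕ.≤-Reasoning
  t = m ∸ suc i

m≤1+i+i⇒m∸[1+i]≤i : ∀ {m i} → m ℕ.≤ suc (i ℕ.+ i) → m ∸ suc i ℕ.≤ i
m≤1+i+i⇒m∸[1+i]≤i {m} {i} m≤1+i+i =
  subst (m ∸ suc i ℕ.≤_) (ℕ.m+n∸n≡m i i) (ℕ.∸-monoˡ-≤ (suc i) m≤1+i+i)

m+n∸k≡[m∸i]+[n∸[k∸i]] : ∀ {m n k i} → i ℕ.≤ k → i ℕ.≤ m → k ∸ i ℕ.≤ n → m ℕ.+ n ∸ k ≡ (m ∸ i) ℕ.+ (n ∸ (k ∸ i))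
m+n∸k≡[m∸i]+[n∸[k∸i]] {m} {n} {k} {i} i≤k i≤m k∸i≤n = begin
  m ℕ.+ n ∸ k                              ≡⟨ cong₂ (λ x y → x ℕ.+ y ∸ k) (ℕ.m∸n+n≡m i≤m) (ℕ.m∸n+n≡m k∸i≤n) ⟨
  (m ∸ i ℕ.+ i) ℕ.+ (n' ℕ.+ (k ∸ i)) ∸ k  ≡⟨ cong (_∸ k) (+-interchange (m ∸ i) i n' (k ∸ i)) ⟩
  (m ∸ i ℕ.+ n') ℕ.+ (i ℕ.+ (k ∸ i)) ∸ k  ≡⟨ cong (λ x → (m ∸ i ℕ.+ n') ℕ.+ x ∸ k) (ℕ.m+[n∸m]≡n i≤k) ⟩
  (m ∸ i ℕ.+ n') ℕ.+ k ∸ k                ≡⟨ ℕ.m+n∸n≡m _ k ⟩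
  m ∸ i ℕ.+ n'                            ∎
  where
  open ≡-Reasoning
  n' = n ∸ (k ∸ i)

[k∸[m∸i]]+[k∸i]≤n : ∀ {m n k i} → i ℕ.≤ m → m ∸ i ℕ.≤ k → i ℕ.≤ k → k ℕ.+ k ℕ.≤ m ℕ.+ n →
  (k ∸ (m ∸ i)) ℕ.+ (k ∸ i) ℕ.≤ n
[k∸[m∸i]]+[k∸i]≤n {m} {n} {k} {i} i≤m m∸i≤k i≤k k+k≤m+n = ℕ.+-cancelʳ-≤ m _ n (begin
  (k ∸ (m ∸ i) ℕ.+ (k ∸ i)) ℕ.+ m              ≡⟨ cong ((k ∸ (m ∸ i) ℕ.+ (k ∸ i)) ℕ.+_) (ℕ.m∸n+n≡m i≤m) ⟨
  (k ∸ (m ∸ i) ℕ.+ (k ∸ i)) ℕ.+ (m ∸ i ℕ.+ i)  ≡⟨ +-interchange (k ∸ (m ∸ i)) (k ∸ i) (m ∸ i) i ⟩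
  (k ∸ (m ∸ i) ℕ.+ (m ∸ i)) ℕ.+ (k ∸ i ℕ.+ i)  ≡⟨ cong₂ ℕ._+_ (ℕ.m∸n+n≡m m∸i≤k) (ℕ.m∸n+n≡m i≤k) ⟩
  k ℕ.+ k                                      ≤⟨ k+k≤m+n ⟩
  m ℕ.+ n                                      ≡⟨ ℕ.+-comm m n ⟩
  n ℕ.+ m                                      ∎)
  where
  open ℕ.≤-Reasoning

-- Configurations and partial assignments

weight≤length : ∀ {n} (η : Vec Bool n) → weight η ℕ.≤ n
weight≤length [] = z≤n
weight≤length (true ∷ η) = s≤s (weight≤length η)
weight≤length (false ∷ η) = ℕ.m≤n⇒m≤1+n (weight≤length η)

weight-flipAll : ∀ {n} (η : Vec Bool n) → weight (flipAll η) ≡ n ∸ weight η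
weight-flipAll [] = refl
weight-flipAll (true ∷ η) = weight-flipAll η
weight-flipAll (false ∷ η) = trans (cong suc (weight-flipAll η)) (sym (ℕ.+-∸-assoc 1 (weight≤length η)))

flipAll-involutive : ∀ {n} (η : Vec Bool n) → flipAll (flipAll η) ≡ η
flipAll-involutive [] = refl
flipAll-involutive (true ∷ η) = cong (true ∷_) (flipAll-involutive η)
flipAll-involutive (false ∷ η) = cong (false ∷_) (flipAll-involutive η)

weight-++ : ∀ {m n} (ξ : Vec Bool m) (η : Vec Bool n) → weight (ξ ++ η) ≡ weight ξ ℕ.+ weight η
weight-++ [] η = refl
weight-++ (true ∷ ξ) η = cong suc (weight-++ ξ η)
weight-++ (false ∷ ξ) η = weight-++ ξ η

take-++ : ∀ {A : Set} m {n} (ξ : Vec A m) (η : Vec A n) → take m (ξ ++ η) ≡ ξ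
take-++ zero [] η = refl
take-++ (suc m) (b ∷ ξ) η = cong (b ∷_) (take-++ m ξ η)

drop-++ : ∀ {A : Set} m {n} (ξ : Vec A m) (η : Vec A n) → drop m (ξ ++ η) ≡ η
drop-++ zero [] η = refl
drop-++ (suc m) (b ∷ ξ) η = drop-++ m ξ η

free-take+free-drop : ∀ m {n} (p : Vec (Maybe Bool) (m ℕ.+ n)) → free p ≡ free (take m p) ℕ.+ free (drop m p)
free-take+free-drop zero p = refl
free-take+free-drop (suc m) (nothing ∷ p) = cong suc (free-take+free-drop m p)
free-take+free-drop (suc m) (just b ∷ p) = free-take+free-drop m p

joinFree : ∀ m {n} (p : Vec (Maybe Bool) (m ℕ.+ n)) →
  Vec Bool (free (take m p)) → Vec Bool (free (drop m p)) → Vec Bool (free p)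
joinFree zero p [] η = η
joinFree (suc m) (nothing ∷ p) (b ∷ ξ) η = b ∷ joinFree m p ξ η
joinFree (suc m) (just b ∷ p) ξ η = joinFree m p ξ η

take-fill-joinFree : ∀ m {n} (p : Vec (Maybe Bool) (m ℕ.+ n)) ξ η → take m (fill p (joinFree m p ξ η)) ≡ fill (take m p) ξ
take-fill-joinFree zero p [] η = refl
take-fill-joinFree (suc m) (nothing ∷ p) (b ∷ ξ) η = cong (b ∷_) (take-fill-joinFree m p ξ η)
take-fill-joinFree (suc m) (just b ∷ p) ξ η = cong (b ∷_) (take-fill-joinFree m p ξ η)

drop-fill-joinFree : ∀ m {n} (p : Vec (Maybe Bool) (m ℕ.+ n)) ξ η → drop m (fill p (joinFree m p ξ η)) ≡ fill (drop m p) η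
drop-fill-joinFree zero p [] η = refl
drop-fill-joinFree (suc m) (nothing ∷ p) (b ∷ ξ) η = drop-fill-joinFree m p ξ η
drop-fill-joinFree (suc m) (just b ∷ p) ξ η = drop-fill-joinFree m p ξ η

weight-joinFree : ∀ m {n} (p : Vec (Maybe Bool) (m ℕ.+ n)) ξ η → weight (joinFree m p ξ η) ≡ weight ξ ℕ.+ weight η
weight-joinFree zero p [] η = refl
weight-joinFree (suc m) (nothing ∷ p) (true ∷ ξ) η = cong suc (weight-joinFree m p ξ η)
weight-joinFree (suc m) (nothing ∷ p) (false ∷ ξ) η = weight-joinFree m p ξ η
weight-joinFree (suc m) (just b ∷ p) ξ η = weight-joinFree m p ξ η

flipAll-joinFree : ∀ m {n} (p : Vec (Maybe Bool) (m ℕ.+ n)) ξ η →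
  flipAll (joinFree m p ξ η) ≡ joinFree m p (flipAll ξ) (flipAll η)
flipAll-joinFree zero p [] η = refl
flipAll-joinFree (suc m) (nothing ∷ p) (b ∷ ξ) η = cong (not b ∷_) (flipAll-joinFree m p ξ η)
flipAll-joinFree (suc m) (just b ∷ p) ξ η = flipAll-joinFree m p ξ η

module OrderedFieldProperties (F : OrderedField) where

  open OrderedField F public

  commutativeRing : CommutativeRing _ _
  commutativeRing = record { isCommutativeRing = isCommutativeRing }

  open CommutativeRing commutativeRing public
    using ( +-assoc; +-comm; +-identityˡ; +-identityʳ; -‿inverseˡ; -‿inverseʳ
          ; *-assoc; *-comm; *-identityˡ; *-identityʳ; distribˡ; distribʳ; zeroˡ; zeroʳ )
  open CommutativeRing commutativeRing using (ring)
  open import Algebra.Properties.Ring ring public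
    using (-0#≈0#; -‿involutive; -‿distribˡ-*; -‿distribʳ-*; -‿anti-homo-+)
  open IsTotalOrder isTotalOrder public
    using (antisym) renaming (refl to ≤-refl; trans to ≤-trans; total to ≤-total)

  infixl 6 _-_
  _-_ : Carrier → Carrier → Carrier
  x - y = x + - y

  fromℕ-+ : ∀ a b → fromℕ F (a ℕ.+ b) ≡ fromℕ F a + fromℕ F b
  fromℕ-+ zero b = sym (+-identityˡ _)
  fromℕ-+ (suc a) b = trans (cong (1# +_) (fromℕ-+ a b)) (sym (+-assoc _ _ _))

  fromℕ-* : ∀ a b → fromℕ F (a ℕ.* b) ≡ fromℕ F a * fromℕ F b
  fromℕ-* zero b = sym (zeroˡ _)
  fromℕ-* (suc a) b = begin
    fromℕ F (b ℕ.+ a ℕ.* b)               ≡⟨ fromℕ-+ b (a ℕ.* b) ⟩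
    fromℕ F b + fromℕ F (a ℕ.* b)         ≡⟨ cong₂ _+_ (sym (*-identityˡ _)) (fromℕ-* a b) ⟩
    1# * fromℕ F b + fromℕ F a * fromℕ F b ≡⟨ distribʳ _ _ _ ⟨
    (1# + fromℕ F a) * fromℕ F b          ∎
    where open ≡-Reasoning

  x-y+y≡x : ∀ x y → x - y + y ≡ x
  x-y+y≡x x y = trans (+-assoc _ _ _) (trans (cong (x +_) (-‿inverseˡ y)) (+-identityʳ x))

  x+y-y≡x : ∀ x y → x + y - y ≡ x
  x+y-y≡x x y = trans (+-assoc _ _ _) (trans (cong (x +_) (-‿inverseʳ y)) (+-identityʳ x))

  fromℕ-∸ : ∀ {m n} → n ℕ.≤ m → fromℕ F (m ℕ.∸ n) ≡ fromℕ F m - fromℕ F n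
  fromℕ-∸ {m} {n} n≤m = begin
    fromℕ F (m ℕ.∸ n)                          ≡⟨ x+y-y≡x _ (fromℕ F n) ⟨
    fromℕ F (m ℕ.∸ n) + fromℕ F n - fromℕ F n  ≡⟨ cong (_- fromℕ F n) (fromℕ-+ (m ℕ.∸ n) n) ⟨
    fromℕ F (m ℕ.∸ n ℕ.+ n) - fromℕ F n        ≡⟨ cong (λ a → fromℕ F a - fromℕ F n) (ℕ.m∸n+n≡m n≤m) ⟩
    fromℕ F m - fromℕ F n                      ∎
    where open ≡-Reasoning

  ⟦_⟧ℤ : ℤ → Carrier
  ⟦ +ℤ n ⟧ℤ = fromℕ F n
  ⟦ -[1+ n ] ⟧ℤ = - fromℕ F (suc n)

  ⟦-⟧ℤ : ∀ i → ⟦ ℤ.- i ⟧ℤ ≡ - ⟦ i ⟧ℤ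
  ⟦-⟧ℤ (+ℤ zero) = sym -0#≈0#
  ⟦-⟧ℤ (+ℤ (suc n)) = refl
  ⟦-⟧ℤ -[1+ n ] = sym (-‿involutive _)

  ⟦⊖⟧ℤ : ∀ m n → ⟦ m ℤ.⊖ n ⟧ℤ ≡ fromℕ F m - fromℕ F n
  ⟦⊖⟧ℤ m n with ℕ.≤-<-connex n m
  ... | inj₁ n≤m = trans (cong ⟦_⟧ℤ (ℤ.⊖-≥ n≤m)) (fromℕ-∸ n≤m)
  ... | inj₂ m<n = begin
    ⟦ m ℤ.⊖ n ⟧ℤ                    ≡⟨ cong ⟦_⟧ℤ (ℤ.⊖-< m<n) ⟩
    ⟦ ℤ.- +ℤ (n ℕ.∸ m) ⟧ℤ           ≡⟨ ⟦-⟧ℤ (+ℤ (n ℕ.∸ m)) ⟩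
    - fromℕ F (n ℕ.∸ m)             ≡⟨ cong -_ (fromℕ-∸ (ℕ.<⇒≤ m<n)) ⟩
    - (fromℕ F n - fromℕ F m)       ≡⟨ -‿anti-homo-+ _ _ ⟩
    - - fromℕ F m - fromℕ F n       ≡⟨ cong (_- fromℕ F n) (-‿involutive _) ⟩
    fromℕ F m - fromℕ F n           ∎
    where open ≡-Reasoning

  ⟦+⟧ℤ : ∀ i j → ⟦ i ℤ.+ j ⟧ℤ ≡ ⟦ i ⟧ℤ + ⟦ j ⟧ℤ
  ⟦+⟧ℤ -[1+ m ] -[1+ n ] = begin
    - fromℕ F (suc (suc (m ℕ.+ n)))           ≡⟨ cong (λ a → - fromℕ F (suc a)) (ℕ.+-suc m n) ⟨
    - fromℕ F (suc m ℕ.+ suc n)               ≡⟨ cong -_ (fromℕ-+ (suc m) (suc n)) ⟩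
    - (fromℕ F (suc m) + fromℕ F (suc n))     ≡⟨ -‿anti-homo-+ _ _ ⟩
    - fromℕ F (suc n) - fromℕ F (suc m)       ≡⟨ +-comm _ _ ⟩
    - fromℕ F (suc m) - fromℕ F (suc n)       ∎
    where open ≡-Reasoning
  ⟦+⟧ℤ -[1+ m ] (+ℤ n) = trans (⟦⊖⟧ℤ n (suc m)) (+-comm _ _)
  ⟦+⟧ℤ (+ℤ m) -[1+ n ] = ⟦⊖⟧ℤ m (suc n)
  ⟦+⟧ℤ (+ℤ m) (+ℤ n) = fromℕ-+ m n

  ⟦-◃⟧ℤ : ∀ k → ⟦ Sign.- ℤ.◃ k ⟧ℤ ≡ - fromℕ F k
  ⟦-◃⟧ℤ k = trans (cong ⟦_⟧ℤ (ℤ.-◃n≡-n k)) (⟦-⟧ℤ (+ℤ k))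

  ⟦*⟧ℤ : ∀ i j → ⟦ i ℤ.* j ⟧ℤ ≡ ⟦ i ⟧ℤ * ⟦ j ⟧ℤ
  ⟦*⟧ℤ (+ℤ m) (+ℤ n) = trans (cong ⟦_⟧ℤ (ℤ.+◃n≡+n (m ℕ.* n))) (fromℕ-* m n)
  ⟦*⟧ℤ (+ℤ m) -[1+ n ] =
    trans (⟦-◃⟧ℤ (m ℕ.* suc n)) (trans (cong -_ (fromℕ-* m (suc n))) (-‿distribʳ-* _ _))
  ⟦*⟧ℤ -[1+ m ] (+ℤ n) =
    trans (⟦-◃⟧ℤ (suc m ℕ.* n)) (trans (cong -_ (fromℕ-* (suc m) n)) (-‿distribˡ-* _ _))
  ⟦*⟧ℤ -[1+ m ] -[1+ n ] = begin
    ⟦ +ℤ (suc m ℕ.* suc n) ⟧ℤ                ≡⟨ cong ⟦_⟧ℤ (ℤ.+◃n≡+n (suc m ℕ.* suc n)) ⟩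
    fromℕ F (suc m ℕ.* suc n)               ≡⟨ fromℕ-* (suc m) (suc n) ⟩
    fromℕ F (suc m) * fromℕ F (suc n)       ≡⟨ -‿involutive _ ⟨
    - - (fromℕ F (suc m) * fromℕ F (suc n)) ≡⟨ cong -_ (-‿distribʳ-* _ _) ⟩
    - (fromℕ F (suc m) * - fromℕ F (suc n)) ≡⟨ -‿distribˡ-* _ _ ⟩
    - fromℕ F (suc m) * - fromℕ F (suc n)   ∎
    where open ≡-Reasoning

  -- The ring solver needs coefficients whose arithmetic computes; ℤ maps into every ring.
  ℤ→F : CommutativeRing.rawRing ℤ.+-*-commutativeRing -Raw-AlmostCommutative⟶ fromCommutativeRing commutativeRing
  ℤ→F = record
    { ⟦_⟧ = ⟦_⟧ℤ ; +-homo = ⟦+⟧ℤ ; *-homo = ⟦*⟧ℤ ; -‿homo = ⟦-⟧ℤ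
    ; 0-homo = refl ; 1-homo = +-identityʳ 1# }

  ⟦⟧ℤ-≟ : ∀ i j → Maybe (⟦ i ⟧ℤ ≡ ⟦ j ⟧ℤ)
  ⟦⟧ℤ-≟ i j with i ℤ.≟ j
  ... | yes i≡j = just (cong ⟦_⟧ℤ i≡j)
  ... | no _ = nothing

  open import Algebra.Solver.Ring (CommutativeRing.rawRing ℤ.+-*-commutativeRing)
    (fromCommutativeRing commutativeRing) ℤ→F ⟦⟧ℤ-≟ public
    using (solve; _:=_; _:+_; _:*_; _:-_; :-_; con)

  fromℕ-*-assoc : ∀ x y z → fromℕ F x * (fromℕ F y * z) ≡ fromℕ F (x ℕ.* y) * z
  fromℕ-*-assoc x y z = trans (sym (*-assoc _ _ _)) (cong (_* z) (sym (fromℕ-* x y)))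

  fromℕ-+-*-split : ∀ p q x y → fromℕ F (p ℕ.+ q) * (x * y) ≡ (fromℕ F p * x) * y + x * (fromℕ F q * y)
  fromℕ-+-*-split p q x y = trans (cong (_* (x * y)) (fromℕ-+ p q))
    (solve 4 (λ p q x y → (p :+ q) :* (x :* y) := (p :* x) :* y :+ x :* (q :* y)) refl _ _ _ _)

  +-mono-≤ : ∀ {x y u v} → x ≤ y → u ≤ v → x + u ≤ y + v
  +-mono-≤ {x} {y} {u} {v} x≤y u≤v = ≤-trans (+-monoˡ-≤ x y u x≤y)
    (subst₂ _≤_ (+-comm u y) (+-comm v y) (+-monoˡ-≤ u v y u≤v))

  +-nonneg : ∀ {x y} → 0# ≤ x → 0# ≤ y → 0# ≤ x + y
  +-nonneg 0≤x 0≤y = subst (_≤ _) (+-identityˡ 0#) (+-mono-≤ 0≤x 0≤y)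

  x≤x+y : ∀ {x y} → 0# ≤ y → x ≤ x + y
  x≤x+y {x} {y} 0≤y = subst (_≤ x + y) (+-identityʳ x) (+-mono-≤ ≤-refl 0≤y)

  x≤y⇒0≤y-x : ∀ {x y} → x ≤ y → 0# ≤ y - x
  x≤y⇒0≤y-x {x} {y} x≤y = subst (_≤ y - x) (-‿inverseʳ x) (+-monoˡ-≤ x y (- x) x≤y)

  0≤y-x⇒x≤y : ∀ {x y} → 0# ≤ y - x → x ≤ y
  0≤y-x⇒x≤y {x} {y} 0≤y-x = subst₂ _≤_ (+-identityˡ x) (x-y+y≡x y x) (+-monoˡ-≤ _ _ x 0≤y-x)

  x≤0⇒0≤-x : ∀ {x} → x ≤ 0# → 0# ≤ - x
  x≤0⇒0≤-x {x} x≤0 = subst₂ _≤_ (-‿inverseʳ x) (+-identityˡ (- x)) (+-monoˡ-≤ _ _ (- x) x≤0)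

  0≤-x⇒x≤0 : ∀ {x} → 0# ≤ - x → x ≤ 0#
  0≤-x⇒x≤0 {x} 0≤-x = subst₂ _≤_ (+-identityˡ x) (-‿inverseˡ x) (+-monoˡ-≤ _ _ x 0≤-x)

  *-monoˡ-≤ : ∀ {c x y} → 0# ≤ c → x ≤ y → c * x ≤ c * y
  *-monoˡ-≤ {c} {x} {y} 0≤c x≤y =
    0≤y-x⇒x≤y (subst (0# ≤_) (distrib c x y) (*-nonneg _ _ 0≤c (x≤y⇒0≤y-x x≤y)))
    where
    distrib : ∀ c x y → c * (y - x) ≡ c * y - c * x
    distrib = solve 3 (λ c x y → c :* (y :- x) := c :* y :- c :* x) refl

  *-mono-≤ : ∀ {x y u v} → 0# ≤ x → 0# ≤ u → x ≤ y → u ≤ v → x * u ≤ y * v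
  *-mono-≤ {x} {y} {u} {v} 0≤x 0≤u x≤y u≤v = ≤-trans (*-monoˡ-≤ 0≤x u≤v)
    (subst₂ _≤_ (*-comm v x) (*-comm v y) (*-monoˡ-≤ (≤-trans 0≤u u≤v) x≤y))

  0≤x+x⇒0≤x : ∀ {x} → 0# ≤ x + x → 0# ≤ x
  0≤x+x⇒0≤x {x} 0≤x+x with ≤-total 0# x
  ... | inj₁ 0≤x = 0≤x
  ... | inj₂ x≤0 = ≤-trans 0≤x+x (subst (x + x ≤_) (+-identityʳ x) (+-mono-≤ ≤-refl x≤0))

  0≤1 : 0# ≤ 1#
  0≤1 with ≤-total 0# 1#
  ... | inj₁ 0≤1 = 0≤1
  ... | inj₂ 1≤0 = ⊥-elim (0≢1 (antisym (subst (0# ≤_) -1*-1≡1 (*-nonneg _ _ 0≤-1 0≤-1)) 1≤0))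
    where
    0≤-1 = x≤0⇒0≤-x 1≤0
    -1*-1≡1 : - 1# * - 1# ≡ 1#
    -1*-1≡1 = trans (solve 1 (λ x → :- x :* :- x := x :* x) refl 1#) (*-identityˡ 1#)

  0≤fromℕ : ∀ n → 0# ≤ fromℕ F n
  0≤fromℕ zero = ≤-refl
  0≤fromℕ (suc n) = +-nonneg 0≤1 (0≤fromℕ n)

  fromℕ-mono-≤ : ∀ {a b} → a ℕ.≤ b → fromℕ F a ≤ fromℕ F b
  fromℕ-mono-≤ {a} {b} a≤b = subst₂ _≤_ (+-identityʳ _)
    (trans (sym (fromℕ-+ a (b ℕ.∸ a))) (cong (fromℕ F) (ℕ.m+[n∸m]≡n a≤b)))
    (+-mono-≤ ≤-refl (0≤fromℕ (b ℕ.∸ a)))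

  0<n⇒fromℕ≢0 : ∀ {n} → 0 ℕ.< n → fromℕ F n ≢ 0#
  0<n⇒fromℕ≢0 {suc n} _ 1+n≡0 =
    0≢1 (antisym 0≤1 (subst₂ _≤_ (+-identityʳ 1#) 1+n≡0 (+-mono-≤ ≤-refl (0≤fromℕ n))))

  0<x⇒0≤x⁻¹ : ∀ {x} → 0# < x → 0# ≤ x ⁻¹
  0<x⇒0≤x⁻¹ {x} (0≤x , 0≢x) with ≤-total 0# (x ⁻¹)
  ... | inj₁ 0≤x⁻¹ = 0≤x⁻¹
  ... | inj₂ x⁻¹≤0 = ⊥-elim (0≢1 (antisym 0≤1 (subst (_≤ 0#) (⁻¹-inverse x (0≢x ∘ sym)) x*x⁻¹≤0)))
    where
    x*x⁻¹≤0 : x * x ⁻¹ ≤ 0#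
    x*x⁻¹≤0 = 0≤-x⇒x≤0 (subst (0# ≤_) (sym (-‿distribʳ-* _ _)) (*-nonneg _ _ 0≤x (x≤0⇒0≤-x x⁻¹≤0)))

  x*y≡1⇒y≡x⁻¹ : ∀ {x y} → x * y ≡ 1# → y ≡ x ⁻¹
  x*y≡1⇒y≡x⁻¹ {x} {y} x*y≡1 = begin
    y                   ≡⟨ *-identityˡ y ⟨
    1# * y              ≡⟨ cong (_* y) (⁻¹-inverse x x≢0) ⟨
    (x * x ⁻¹) * y      ≡⟨ solve 3 (λ a b c → (a :* b) :* c := (a :* c) :* b) refl x (x ⁻¹) y ⟩
    (x * y) * x ⁻¹      ≡⟨ cong (_* x ⁻¹) x*y≡1 ⟩
    1# * x ⁻¹           ≡⟨ *-identityˡ _ ⟩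
    x ⁻¹                ∎
    where
    open ≡-Reasoning
    x≢0 : x ≢ 0#
    x≢0 x≡0 = 0≢1 (trans (sym (zeroˡ y)) (trans (cong (_* y) (sym x≡0)) x*y≡1))

  ⁻¹-distrib-* : ∀ {x y} → x ≢ 0# → y ≢ 0# → (x * y) ⁻¹ ≡ x ⁻¹ * y ⁻¹
  ⁻¹-distrib-* {x} {y} x≢0 y≢0 = sym (x*y≡1⇒y≡x⁻¹ (begin
    (x * y) * (x ⁻¹ * y ⁻¹)     ≡⟨ solve 4 (λ a b c d → (a :* b) :* (c :* d) := (a :* c) :* (b :* d)) refl x y (x ⁻¹) (y ⁻¹) ⟩
    (x * x ⁻¹) * (y * y ⁻¹)     ≡⟨ cong₂ _*_ (⁻¹-inverse x x≢0) (⁻¹-inverse y y≢0) ⟩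
    1# * 1#                     ≡⟨ *-identityˡ 1# ⟩
    1#                          ∎))
    where open ≡-Reasoning

  y⁻¹*z≡[x*y]⁻¹*[x*z] : ∀ {x y} z → x ≢ 0# → y ≢ 0# → y ⁻¹ * z ≡ (x * y) ⁻¹ * (x * z)
  y⁻¹*z≡[x*y]⁻¹*[x*z] {x} {y} z x≢0 y≢0 = sym (begin
    (x * y) ⁻¹ * (x * z)        ≡⟨ cong (_* (x * z)) (⁻¹-distrib-* x≢0 y≢0) ⟩
    (x ⁻¹ * y ⁻¹) * (x * z)     ≡⟨ solve 4 (λ a b c d → (a :* b) :* (c :* d) := (c :* a) :* (b :* d)) refl (x ⁻¹) (y ⁻¹) x z ⟩
    (x * x ⁻¹) * (y ⁻¹ * z)     ≡⟨ cong (_* (y ⁻¹ * z)) (⁻¹-inverse x x≢0) ⟩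
    1# * (y ⁻¹ * z)             ≡⟨ *-identityˡ _ ⟩
    y ⁻¹ * z                    ∎)
    where open ≡-Reasoning

  *-≢0 : ∀ {x y} → x ≢ 0# → y ≢ 0# → x * y ≢ 0#
  *-≢0 {x} {y} x≢0 y≢0 x*y≡0 = y≢0 (begin
    y                  ≡⟨ *-identityˡ y ⟨
    1# * y             ≡⟨ cong (_* y) (trans (*-comm _ _) (⁻¹-inverse x x≢0)) ⟨
    (x ⁻¹ * x) * y     ≡⟨ *-assoc _ _ _ ⟩
    x ⁻¹ * (x * y)     ≡⟨ cong (x ⁻¹ *_) x*y≡0 ⟩
    x ⁻¹ * 0#          ≡⟨ zeroʳ _ ⟩
    0#                 ∎)
    where open ≡-Reasoning

  ≤-poset : Poset _ _ _
  ≤-poset = record { isPartialOrder = IsTotalOrder.isPartialOrder isTotalOrder }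

  module ≤-Reasoning = PosetReasoning ≤-poset

module FiniteSums (F : OrderedField) where

  open OrderedFieldProperties F

  private variable A B : Set

  sum< : ℕ → (ℕ → Carrier) → Carrier
  sum< zero f = 0#
  sum< (suc n) f = sum< n f + f n

  syntax sum< n (λ i → e) = ∑[ i < n ] e

  when : ∀ {P : Set} → Dec P → Carrier → Carrier
  when (yes _) x = x
  when (no _) x = 0#

  when-cong : ∀ {P Q : Set} (p : Dec P) (q : Dec Q) x → (P → Q) → (Q → P) → when p x ≡ when q x
  when-cong (yes _) (yes _) x P→Q Q→P = refl
  when-cong (yes p) (no ¬q) x P→Q Q→P = contradiction (P→Q p) ¬q
  when-cong (no ¬p) (yes q) x P→Q Q→P = contradiction (Q→P q) ¬p
  when-cong (no _) (no _) x P→Q Q→P = refl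

  when-*ˡ : ∀ {P : Set} (p : Dec P) x y → when p x * y ≡ when p (x * y)
  when-*ˡ (yes _) x y = refl
  when-*ˡ (no _) x y = zeroˡ y

  when-*ʳ : ∀ {P : Set} (p : Dec P) x y → x * when p y ≡ when p (x * y)
  when-*ʳ (yes _) x y = refl
  when-*ʳ (no _) x y = zeroʳ x

  when-nonneg : ∀ {P : Set} (p : Dec P) {x} → 0# ≤ x → 0# ≤ when p x
  when-nonneg (yes _) 0≤x = 0≤x
  when-nonneg (no _) _ = ≤-refl

  sum<-cong : ∀ n {f g} → (∀ i → i ℕ.< n → f i ≡ g i) → sum< n f ≡ sum< n g
  sum<-cong zero f≗g = refl
  sum<-cong (suc n) f≗g = cong₂ _+_ (sum<-cong n (λ i i<n → f≗g i (ℕ.m≤n⇒m≤1+n i<n))) (f≗g n ℕ.≤-refl)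

  sum<-zero : ∀ n {f} → (∀ i → i ℕ.< n → f i ≡ 0#) → sum< n f ≡ 0#
  sum<-zero zero f≗0 = refl
  sum<-zero (suc n) f≗0 =
    trans (cong₂ _+_ (sum<-zero n (λ i i<n → f≗0 i (ℕ.m≤n⇒m≤1+n i<n))) (f≗0 n ℕ.≤-refl)) (+-identityˡ 0#)

  sum<-+ : ∀ n f g → ∑[ i < n ] (f i + g i) ≡ sum< n f + sum< n g
  sum<-+ zero f g = sym (+-identityˡ 0#)
  sum<-+ (suc n) f g = trans (cong (_+ (f n + g n)) (sum<-+ n f g))
    (solve 4 (λ a b c d → (a :+ b) :+ (c :+ d) := (a :+ c) :+ (b :+ d)) refl _ _ _ _)

  sum<-*ˡ : ∀ n c f → c * sum< n f ≡ ∑[ i < n ] (c * f i)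
  sum<-*ˡ zero c f = zeroʳ c
  sum<-*ˡ (suc n) c f = trans (distribˡ c _ _) (cong (_+ c * f n) (sum<-*ˡ n c f))

  sum<-nonneg : ∀ n {f} → (∀ i → i ℕ.< n → 0# ≤ f i) → 0# ≤ sum< n f
  sum<-nonneg zero 0≤f = ≤-refl
  sum<-nonneg (suc n) 0≤f = +-nonneg (sum<-nonneg n (λ i i<n → 0≤f i (ℕ.m≤n⇒m≤1+n i<n))) (0≤f n ℕ.≤-refl)

  sum<-suc : ∀ n f → sum< (suc n) f ≡ f 0 + ∑[ i < n ] f (suc i)
  sum<-suc zero f = trans (+-identityˡ _) (sym (+-identityʳ _))
  sum<-suc (suc n) f = trans (cong (_+ f (suc n)) (sum<-suc n f)) (+-assoc _ _ _)

  sum<-+-length : ∀ m n f → sum< (m ℕ.+ n) f ≡ sum< m f + ∑[ j < n ] f (m ℕ.+ j)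
  sum<-+-length m zero f = trans (cong (λ l → sum< l f) (ℕ.+-identityʳ m)) (sym (+-identityʳ _))
  sum<-+-length m (suc n) f = trans (cong (λ l → sum< l f) (ℕ.+-suc m n))
    (trans (cong (_+ f (m ℕ.+ n)) (sum<-+-length m n f)) (+-assoc _ _ _))

  sum<-extend : ∀ m n {f} → (∀ j → j ℕ.< n → f (m ℕ.+ j) ≡ 0#) → sum< (m ℕ.+ n) f ≡ sum< m f
  sum<-extend m n f≗0 =
    trans (sum<-+-length m n _) (trans (cong (_ +_) (sum<-zero n f≗0)) (+-identityʳ _))

  sum<-reverse : ∀ n f → sum< n f ≡ ∑[ i < n ] f (n ℕ.∸ suc i)
  sum<-reverse zero f = refl
  sum<-reverse (suc n) f = trans (cong (_+ f n) (sum<-reverse n f))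
    (trans (+-comm _ _) (sym (sum<-suc n (λ i → f (n ℕ.∸ i)))))

  sum<-indicator : ∀ n a (f : ℕ → Carrier) → a ℕ.< n → ∑[ i < n ] when (a ℕ.≟ i) (f i) ≡ f a
  sum<-indicator (suc n) a f a<1+n with a ℕ.≟ n
  ... | yes refl = trans (cong (_+ f a) (sum<-zero n off)) (+-identityˡ _)
    where
    off : ∀ i → i ℕ.< a → when (a ℕ.≟ i) (f i) ≡ 0#
    off i i<a with a ℕ.≟ i
    ... | yes refl = ⊥-elim (ℕ.<-irrefl refl i<a)
    ... | no _ = refl
  ... | no a≢n = trans (+-identityʳ _) (sum<-indicator n a f (ℕ.≤∧≢⇒< (ℕ.≤-pred a<1+n) a≢n))

  sum<-indicator-≥ : ∀ n a (f : ℕ → Carrier) → n ℕ.≤ a → ∑[ i < n ] when (a ℕ.≟ i) (f i) ≡ 0#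
  sum<-indicator-≥ n a f n≤a = sum<-zero n off
    where
    off : ∀ i → i ℕ.< n → when (a ℕ.≟ i) (f i) ≡ 0#
    off i i<n with a ℕ.≟ i
    ... | yes refl = ⊥-elim (ℕ.<-irrefl refl (ℕ.<-≤-trans i<n n≤a))
    ... | no _ = refl

  sumL-cong : ∀ {f g : A → Carrier} xs → (∀ x → f x ≡ g x) → sumL F f xs ≡ sumL F g xs
  sumL-cong [] f≗g = refl
  sumL-cong (x ∷ xs) f≗g = cong₂ _+_ (f≗g x) (sumL-cong xs f≗g)

  sumL-+ : ∀ (f g : A → Carrier) xs → sumL F (λ x → f x + g x) xs ≡ sumL F f xs + sumL F g xs
  sumL-+ f g [] = sym (+-identityˡ 0#)
  sumL-+ f g (x ∷ xs) = trans (cong (f x + g x +_) (sumL-+ f g xs))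
    (solve 4 (λ a b c d → (a :+ b) :+ (c :+ d) := (a :+ c) :+ (b :+ d)) refl _ _ _ _)

  sumL-*ˡ : ∀ c (f : A → Carrier) xs → c * sumL F f xs ≡ sumL F (λ x → c * f x) xs
  sumL-*ˡ c f [] = zeroʳ c
  sumL-*ˡ c f (x ∷ xs) = trans (distribˡ c _ _) (cong (c * f x +_) (sumL-*ˡ c f xs))

  sumL-++ : ∀ (f : A → Carrier) xs ys → sumL F f (xs List.++ ys) ≡ sumL F f xs + sumL F f ys
  sumL-++ f [] ys = sym (+-identityˡ _)
  sumL-++ f (x ∷ xs) ys = trans (cong (f x +_) (sumL-++ f xs ys)) (sym (+-assoc _ _ _))

  sumL-map : (f : B → Carrier) (g : A → B) (xs : List A) → sumL F f (List.map g xs) ≡ sumL F (λ x → f (g x)) xs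
  sumL-map f g [] = refl
  sumL-map f g (x ∷ xs) = cong (f (g x) +_) (sumL-map f g xs)

  sumL-nonneg : ∀ {f : A → Carrier} xs → (∀ x → 0# ≤ f x) → 0# ≤ sumL F f xs
  sumL-nonneg [] 0≤f = ≤-refl
  sumL-nonneg (x ∷ xs) 0≤f = +-nonneg (0≤f x) (sumL-nonneg xs 0≤f)

  sumL-filter : ∀ {P : Pred A _} (P? : Decidable P) (f : A → Carrier) xs →
    sumL F f (filter P? xs) ≡ sumL F (λ x → when (P? x) (f x)) xs
  sumL-filter P? f [] = refl
  sumL-filter P? f (x ∷ xs) with P? x
  ... | yes _ = cong (f x +_) (sumL-filter P? f xs)
  ... | no _ = trans (sumL-filter P? f xs) (sym (+-identityˡ _))

  sumL-sum< : ∀ n (f : ℕ → A → Carrier) xs → ∑[ i < n ] sumL F (f i) xs ≡ sumL F (λ x → ∑[ i < n ] f i x) xs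
  sumL-sum< zero f [] = refl
  sumL-sum< zero f (x ∷ xs) = trans (sumL-sum< zero f xs) (sym (+-identityˡ _))
  sumL-sum< (suc n) f xs = trans (cong (_+ sumL F (f n) xs) (sumL-sum< n f xs)) (sym (sumL-+ _ _ xs))

  sumL-product : (f : A → Carrier) (g : B → Carrier) (xs : List A) (ys : List B) →
    sumL F f xs * sumL F g ys ≡ sumL F (λ x → sumL F (λ y → f x * g y) ys) xs
  sumL-product f g xs ys = begin
    sumL F f xs * sumL F g ys                       ≡⟨ *-comm _ _ ⟩
    sumL F g ys * sumL F f xs                       ≡⟨ sumL-*ˡ _ f xs ⟩
    sumL F (λ x → sumL F g ys * f x) xs             ≡⟨ sumL-cong xs (λ x → trans (*-comm _ _) (sumL-*ˡ (f x) g ys)) ⟩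
    sumL F (λ x → sumL F (λ y → f x * g y) ys) xs   ∎
    where open ≡-Reasoning

  sum<-pairs-nonneg : ∀ m {f} → (∀ i → i ℕ.+ i ℕ.≤ m → 0# ≤ f i + f (m ℕ.∸ i)) → 0# ≤ sum< (suc m) f
  sum<-pairs-nonneg m {f} pair-nonneg = 0≤x+x⇒0≤x (subst (0# ≤_) pairs≡twice (sum<-nonneg (suc m) pair))
    where
    pairs≡twice : ∑[ i < suc m ] (f i + f (m ℕ.∸ i)) ≡ sum< (suc m) f + sum< (suc m) f
    pairs≡twice = trans (sum<-+ (suc m) f _) (cong (sum< (suc m) f +_) (sym (sum<-reverse (suc m) f)))
    pair : ∀ i → i ℕ.< suc m → 0# ≤ f i + f (m ℕ.∸ i)
    pair i i<1+m with (i ℕ.+ i) ℕ.≤? m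
    ... | yes i+i≤m = pair-nonneg i i+i≤m
    ... | no i+i≰m = subst (0# ≤_) (trans (+-comm _ _) (cong (λ j → f j + f (m ℕ.∸ i)) (ℕ.m∸[m∸n]≡n i≤m)))
      (pair-nonneg (m ℕ.∸ i) (ℕ.≤-trans (ℕ.+-monoʳ-≤ (m ℕ.∸ i) m∸i≤i) (ℕ.≤-reflexive (ℕ.m∸n+n≡m i≤m))))
      where
      i≤m = ℕ.≤-pred i<1+m
      m∸i≤i : m ℕ.∸ i ℕ.≤ i
      m∸i≤i = ℕ.+-cancelʳ-≤ i _ i (ℕ.≤-trans (ℕ.≤-reflexive (ℕ.m∸n+n≡m i≤m)) (ℕ.<⇒≤ (ℕ.≰⇒> i+i≰m)))

  sumL-allVecs-suc : ∀ {n} (f : Vec Bool (suc n) → Carrier) →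
    sumL F f (allVecs (suc n)) ≡ sumL F (λ η → f (true ∷ η)) (allVecs n) + sumL F (λ η → f (false ∷ η)) (allVecs n)
  sumL-allVecs-suc {n} f = trans (sumL-++ f (List.map (true ∷_) (allVecs n)) _)
    (cong₂ _+_ (sumL-map f _ (allVecs n)) (sumL-map f _ (allVecs n)))

  sumL-allVecs-flipAll : ∀ n (f : Vec Bool n → Carrier) → sumL F f (allVecs n) ≡ sumL F (λ η → f (flipAll η)) (allVecs n)
  sumL-allVecs-flipAll zero f = refl
  sumL-allVecs-flipAll (suc n) f = begin
    sumL F f (allVecs (suc n))
      ≡⟨ sumL-allVecs-suc f ⟩
    sumL F (λ η → f (true ∷ η)) (allVecs n) + sumL F (λ η → f (false ∷ η)) (allVecs n)
      ≡⟨ cong₂ _+_ (sumL-allVecs-flipAll n _) (sumL-allVecs-flipAll n _) ⟩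
    sumL F (λ η → f (true ∷ flipAll η)) (allVecs n) + sumL F (λ η → f (false ∷ flipAll η)) (allVecs n)
      ≡⟨ +-comm _ _ ⟩
    sumL F (λ η → f (false ∷ flipAll η)) (allVecs n) + sumL F (λ η → f (true ∷ flipAll η)) (allVecs n)
      ≡⟨ sumL-allVecs-suc (λ η → f (flipAll η)) ⟨
    sumL F (λ η → f (flipAll η)) (allVecs (suc n)) ∎
    where open ≡-Reasoning

module Sequences (F : OrderedField) where

  open OrderedFieldProperties F

  Symmetric : ℕ → (ℕ → Carrier) → Set
  Symmetric m s = ∀ i → i ℕ.≤ m → s i ≡ s (m ∸ i)

  RisesToMiddle : ℕ → (ℕ → Carrier) → Set
  RisesToMiddle m s = ∀ i → suc (i ℕ.+ i) ℕ.≤ m → s i ≤ s (suc i)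

  Nonneg : (ℕ → Carrier) → Set
  Nonneg s = ∀ i → 0# ≤ s i

  symmetric-mirror : ∀ {m s} → Symmetric m s → ∀ {i} → suc i ℕ.≤ m →
    s (suc i) ≡ s (m ∸ suc i) × s i ≡ s (suc (m ∸ suc i))
  symmetric-mirror {m} {s} sym-s {i} 1+i≤m =
    sym-s (suc i) 1+i≤m , trans (sym-s i (ℕ.<⇒≤ 1+i≤m)) (cong s (ℕ.+-∸-assoc 1 1+i≤m))

  symmetric∧risesToMiddle⇒unimodal : ∀ {m s} → Symmetric m s → RisesToMiddle m s → Unimodal F m s
  symmetric∧risesToMiddle⇒unimodal {m} {s} sym-s rises = h , h≤m , increasing , decreasing
    where
    h = ⌊ m /2⌋
    h≤m = ℕ.≤-trans (ℕ.m≤m+n h h) (⌊n/2⌋+⌊n/2⌋≤n m)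
    increasing : ∀ i → i ℕ.< h → s i ≤ s (suc i)
    increasing i i<h = rises i (ℕ.≤-trans (ℕ.+-mono-≤ i<h (ℕ.<⇒≤ i<h)) (⌊n/2⌋+⌊n/2⌋≤n m))
    decreasing : ∀ i → h ℕ.≤ i → i ℕ.< m → s (suc i) ≤ s i
    decreasing i h≤i 1+i≤m with symmetric-mirror sym-s 1+i≤m
    ... | s[1+i]≡s[t] , s[i]≡s[1+t] = subst₂ _≤_ (sym s[1+i]≡s[t]) (sym s[i]≡s[1+t])
      (rises (m ∸ suc i) (m∸[1+i]≤i⇒1+[m∸[1+i]]+[m∸[1+i]]≤m 1+i≤m
        (m≤1+i+i⇒m∸[1+i]≤i (ℕ.≤-trans (n≤1+⌊n/2⌋+⌊n/2⌋ m) (s≤s (ℕ.+-mono-≤ h≤i h≤i))))))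

  unimodal∧symmetric⇒risesToMiddle : ∀ {m s} → Unimodal F m s → Symmetric m s → RisesToMiddle m s
  unimodal∧symmetric⇒risesToMiddle {m} {s} (k , k≤m , increasing , decreasing) sym-s i 1+i+i≤m =
    rises (i ℕ.<? k)
    where
    1+i≤m = ℕ.≤-trans (s≤s (ℕ.m≤m+n i i)) 1+i+i≤m
    rises : Dec (i ℕ.< k) → s i ≤ s (suc i)
    rises (yes i<k) = increasing i i<k
    rises (no i≮k) with symmetric-mirror sym-s 1+i≤m
    ... | s[1+i]≡s[t] , s[i]≡s[1+t] = subst₂ _≤_ (sym s[i]≡s[1+t]) (sym s[1+i]≡s[t])
      (decreasing (m ∸ suc i) (ℕ.≤-trans (ℕ.≮⇒≥ i≮k) (1+i+i≤m⇒i≤m∸[1+i] 1+i+i≤m)) (ℕ.∸-monoʳ-< (s≤s z≤n) 1+i≤m))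

  risesToMiddle⇒≤ : ∀ {m s} → RisesToMiddle m s → ∀ {i j} → i ℕ.≤ j → j ℕ.+ j ℕ.≤ m → s i ≤ s j
  risesToMiddle⇒≤ rises {j = zero} z≤n _ = ≤-refl
  risesToMiddle⇒≤ {m} {s} rises {i} {suc j} i≤1+j 2+2j≤m with ℕ.m≤n⇒m<n∨m≡n i≤1+j
  ... | inj₂ refl = ≤-refl
  ... | inj₁ (s≤s i≤j) = ≤-trans (risesToMiddle⇒≤ rises i≤j (ℕ.≤-trans (ℕ.+-mono-≤ (ℕ.n≤1+n j) (ℕ.n≤1+n j)) 2+2j≤m))
    (rises j (ℕ.≤-trans (s≤s (ℕ.+-monoʳ-≤ j (ℕ.n≤1+n j))) 2+2j≤m))

  symmetric∧risesToMiddle⇒≤ : ∀ {m s} → Symmetric m s → RisesToMiddle m s →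
    ∀ {i j} → i ℕ.≤ j → i ℕ.+ j ℕ.≤ m → s i ≤ s j
  symmetric∧risesToMiddle⇒≤ {m} {s} sym-s rises {i} {j} i≤j i+j≤m with (j ℕ.+ j) ℕ.≤? m
  ... | yes j+j≤m = risesToMiddle⇒≤ rises i≤j j+j≤m
  ... | no j+j≰m = subst (s i ≤_) (sym (sym-s j j≤m)) (risesToMiddle⇒≤ rises i≤m∸j (ℕ.≤-trans (ℕ.+-monoʳ-≤ t t≤j) t+j≤m))
    where
    j≤m = ℕ.m+n≤o⇒n≤o i i+j≤m
    t = m ∸ j
    i≤m∸j = ℕ.m+n≤o⇒m≤o∸n i i+j≤m
    t+j≤m : t ℕ.+ j ℕ.≤ m
    t+j≤m = ℕ.≤-reflexive (ℕ.m∸n+n≡m j≤m)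
    t≤j : t ℕ.≤ j
    t≤j = ℕ.+-cancelʳ-≤ j t j (ℕ.≤-trans t+j≤m (ℕ.<⇒≤ (ℕ.≰⇒> j+j≰m)))

  VanishesAbove : ℕ → (ℕ → Carrier) → Set
  VanishesAbove m a = ∀ i → m ℕ.< i → a i ≡ 0#

  weighted : ℕ → (ℕ → Carrier) → ℕ → Carrier
  weighted m s i = fromℕ F (m C i) * s i

  weighted-vanishes : ∀ m s → VanishesAbove m (weighted m s)
  weighted-vanishes m s i m<i = trans (cong (λ c → fromℕ F c * s i) (k>n⇒nCk≡0 m<i)) (zeroˡ _)

  weighted-nonneg : ∀ {m s} → Nonneg s → Nonneg (weighted m s)
  weighted-nonneg {m} 0≤s i = *-nonneg _ _ (0≤fromℕ (m C i)) (0≤s i)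

  weighted-symmetric : ∀ {m s} → Symmetric m s → Symmetric m (weighted m s)
  weighted-symmetric sym-s i i≤m = cong₂ _*_ (cong (fromℕ F) (nCk≡nC[n∸k] i≤m)) (sym-s i i≤m)

  weighted-risesToMiddle : ∀ {m s} → Nonneg s → RisesToMiddle m s → RisesToMiddle m (weighted m s)
  weighted-risesToMiddle {m} 0≤s rises i 1+i+i≤m =
    *-mono-≤ (0≤fromℕ (m C i)) (0≤s i) (fromℕ-mono-≤ (k+k<n⇒nCk≤nC[k+1] 1+i+i≤m)) (rises i 1+i+i≤m)

  normalized : ℕ → (ℕ → Carrier) → ℕ → Carrier
  normalized m a k = (fromℕ F (m C k)) ⁻¹ * a k

  normalized-symmetric : ∀ {m a} → Symmetric m a → Symmetric m (normalized m a)
  normalized-symmetric sym-a i i≤m = cong₂ (λ c x → (fromℕ F c) ⁻¹ * x) (nCk≡nC[n∸k] i≤m) (sym-a i i≤m)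

  -- (m ∸ k) · C(m,k) = (k+1) · C(m,k+1) is a common denominator of both sides.
  normalized-risesToMiddle : ∀ {m a} →
    (∀ k → suc (k ℕ.+ k) ℕ.≤ m → fromℕ F (m ∸ k) * a k ≤ fromℕ F (suc k) * a (suc k)) →
    RisesToMiddle m (normalized m a)
  normalized-risesToMiddle {m} {a} ratio k 1+k+k≤m = begin
    normalized m a k                          ≡⟨ y⁻¹*z≡[x*y]⁻¹*[x*z] (a k) m∸k≢0 mCk≢0 ⟩
    D ⁻¹ * (fromℕ F (m ∸ k) * a k)            ≤⟨ *-monoˡ-≤ (0<x⇒0≤x⁻¹ (0≤D , D≢0 ∘ sym)) (ratio k 1+k+k≤m) ⟩
    D ⁻¹ * (fromℕ F (suc k) * a (suc k))      ≡⟨ cong (λ d → d ⁻¹ * (fromℕ F (suc k) * a (suc k))) D≡ ⟩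
    D' ⁻¹ * (fromℕ F (suc k) * a (suc k))     ≡⟨ y⁻¹*z≡[x*y]⁻¹*[x*z] (a (suc k)) 1+k≢0 mC[1+k]≢0 ⟨
    normalized m a (suc k)                    ∎
    where
    open ≤-Reasoning
    1+k≤m = ℕ.≤-trans (s≤s (ℕ.m≤m+n k k)) 1+k+k≤m
    D D' : Carrier
    D = fromℕ F (m ∸ k) * fromℕ F (m C k)
    D' = fromℕ F (suc k) * fromℕ F (m C suc k)
    m∸k≢0 : fromℕ F (m ∸ k) ≢ 0#
    m∸k≢0 = 0<n⇒fromℕ≢0 (ℕ.m<n⇒0<n∸m 1+k≤m)
    mCk≢0 : fromℕ F (m C k) ≢ 0#
    mCk≢0 = 0<n⇒fromℕ≢0 (k≤n⇒0<nCk (ℕ.<⇒≤ 1+k≤m))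
    1+k≢0 : fromℕ F (suc k) ≢ 0#
    1+k≢0 = 0<n⇒fromℕ≢0 {suc k} (s≤s z≤n)
    mC[1+k]≢0 : fromℕ F (m C suc k) ≢ 0#
    mC[1+k]≢0 = 0<n⇒fromℕ≢0 (k≤n⇒0<nCk 1+k≤m)
    0≤D : 0# ≤ D
    0≤D = *-nonneg _ _ (0≤fromℕ (m ∸ k)) (0≤fromℕ (m C k))
    D≢0 : D ≢ 0#
    D≢0 = *-≢0 m∸k≢0 mCk≢0
    D≡ : D ≡ D'
    D≡ = trans (sym (fromℕ-* (m ∸ k) (m C k)))
      (trans (cong (fromℕ F) (sym ([k+1]*nC[k+1]≡[n∸k]*nCk m k))) (fromℕ-* (suc k) (m C suc k)))

module Convolution (F : OrderedField) where

  open OrderedFieldProperties F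
  open FiniteSums F
  open Sequences F

  infixl 7 _⋆_
  _⋆_ : (ℕ → Carrier) → (ℕ → Carrier) → ℕ → Carrier
  (a ⋆ b) k = ∑[ i < suc k ] (a i * b (k ∸ i))

  ⋆-comm : ∀ a b k → (a ⋆ b) k ≡ (b ⋆ a) k
  ⋆-comm a b k = trans (sum<-reverse (suc k) _)
    (sum<-cong (suc k) (λ i i<1+k → trans (*-comm _ _) (cong (λ j → b j * a (k ∸ i)) (ℕ.m∸[m∸n]≡n (ℕ.≤-pred i<1+k)))))

  ⋆-cong : ∀ {a a' b b'} → (∀ i → a i ≡ a' i) → (∀ j → b j ≡ b' j) → ∀ k → (a ⋆ b) k ≡ (a' ⋆ b') k
  ⋆-cong a≗a' b≗b' k = sum<-cong (suc k) (λ i _ → cong₂ _*_ (a≗a' i) (b≗b' (k ∸ i)))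

  ⋆-+ˡ : ∀ a a' b k → ((λ i → a i + a' i) ⋆ b) k ≡ (a ⋆ b) k + (a' ⋆ b) k
  ⋆-+ˡ a a' b k = trans (sum<-cong (suc k) (λ i _ → distribʳ (b (k ∸ i)) (a i) (a' i))) (sum<-+ (suc k) _ _)

  ⋆-*ˡ : ∀ c a b k → ((λ i → c * a i) ⋆ b) k ≡ c * (a ⋆ b) k
  ⋆-*ˡ c a b k = trans (sum<-cong (suc k) (λ i _ → *-assoc c (a i) (b (k ∸ i)))) (sym (sum<-*ˡ (suc k) c _))

  indicator-⋆ : ∀ a b k x y →
    ((λ i → when (a ℕ.≟ i) x) ⋆ (λ j → when (b ℕ.≟ j) y)) k ≡ when (a ℕ.+ b ℕ.≟ k) (x * y)
  indicator-⋆ a b k x y =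
    trans (sum<-cong (suc k) (λ i _ → when-*ˡ (a ℕ.≟ i) x _)) (by-a<1+k (a ℕ.<? suc k))
    where
    by-a<1+k : Dec (a ℕ.< suc k) → ∑[ i < suc k ] when (a ℕ.≟ i) (x * when (b ℕ.≟ k ∸ i) y) ≡ when (a ℕ.+ b ℕ.≟ k) (x * y)
    by-a<1+k (yes a<1+k) = trans (sum<-indicator (suc k) a _ a<1+k)
      (trans (when-*ʳ (b ℕ.≟ k ∸ a) x y) (when-cong (b ℕ.≟ k ∸ a) (a ℕ.+ b ℕ.≟ k) _
        (λ b≡k∸a → trans (cong (a ℕ.+_) b≡k∸a) (ℕ.m+[n∸m]≡n (ℕ.≤-pred a<1+k)))
        (λ a+b≡k → trans (sym (ℕ.m+n∸m≡n a b)) (cong (_∸ a) a+b≡k))))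
    by-a<1+k (no a≮1+k) = trans (sum<-indicator-≥ (suc k) a _ (ℕ.≮⇒≥ a≮1+k)) (sym (when-no (a ℕ.+ b ℕ.≟ k)))
      where
      when-no : (d : Dec (a ℕ.+ b ≡ k)) → when d (x * y) ≡ 0#
      when-no (yes a+b≡k) = contradiction (s≤s (subst (a ℕ.≤_) a+b≡k (ℕ.m≤m+n a b))) a≮1+k
      when-no (no _) = refl

  ∂ : (ℕ → Carrier) → ℕ → Carrier
  ∂ a i = fromℕ F (suc i) * a (suc i)

  -- for a polynomial A of degree at most m, these are the coefficients of m·A − x·A′
  ∂ʳ : ℕ → (ℕ → Carrier) → ℕ → Carrier
  ∂ʳ m a i = fromℕ F (m ∸ i) * a i

  ∂-⋆ : ∀ a b k → fromℕ F (suc k) * (a ⋆ b) (suc k) ≡ (∂ a ⋆ b) k + (a ⋆ ∂ b) k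
  ∂-⋆ a b k = begin
    fromℕ F (suc k) * (a ⋆ b) (suc k)                   ≡⟨ sum<-*ˡ (2 ℕ.+ k) _ _ ⟩
    ∑[ i < 2 ℕ.+ k ] (fromℕ F (suc k) * (a i * b (suc k ∸ i)))
                                                        ≡⟨ sum<-cong (2 ℕ.+ k) split ⟩
    ∑[ i < 2 ℕ.+ k ] (left i + right i)                 ≡⟨ sum<-+ (2 ℕ.+ k) left right ⟩
    sum< (2 ℕ.+ k) left + sum< (2 ℕ.+ k) right          ≡⟨ cong₂ _+_ left-sum right-sum ⟩
    (∂ a ⋆ b) k + (a ⋆ ∂ b) k                           ∎
    where
    open ≡-Reasoning
    left right : ℕ → Carrier
    left i = (fromℕ F i * a i) * b (suc k ∸ i)
    right i = a i * (fromℕ F (suc k ∸ i) * b (suc k ∸ i))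
    split : ∀ i → i ℕ.< 2 ℕ.+ k → fromℕ F (suc k) * (a i * b (suc k ∸ i)) ≡ left i + right i
    split i i<2+k = trans (cong (λ j → fromℕ F j * (a i * b (suc k ∸ i))) (sym (ℕ.m+[n∸m]≡n (ℕ.≤-pred i<2+k))))
      (fromℕ-+-*-split i (suc k ∸ i) (a i) (b (suc k ∸ i)))
    left-sum : sum< (2 ℕ.+ k) left ≡ (∂ a ⋆ b) k
    left-sum = begin
      sum< (2 ℕ.+ k) left              ≡⟨ sum<-suc (suc k) left ⟩
      left 0 + (∂ a ⋆ b) k             ≡⟨ cong (_+ (∂ a ⋆ b) k) (trans (cong (_* b (suc k)) (zeroˡ (a 0))) (zeroˡ _)) ⟩
      0# + (∂ a ⋆ b) k                 ≡⟨ +-identityˡ _ ⟩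
      (∂ a ⋆ b) k                      ∎
    right-last : right (suc k) ≡ 0#
    right-last = trans (cong (λ j → a (suc k) * (fromℕ F j * b j)) (ℕ.n∸n≡0 k))
      (trans (cong (a (suc k) *_) (zeroˡ _)) (zeroʳ _))
    right-sum : sum< (2 ℕ.+ k) right ≡ (a ⋆ ∂ b) k
    right-sum = begin
      sum< (suc k) right + right (suc k)   ≡⟨ cong (sum< (suc k) right +_) right-last ⟩
      sum< (suc k) right + 0#              ≡⟨ +-identityʳ _ ⟩
      sum< (suc k) right                   ≡⟨ sum<-cong (suc k) (λ i i<1+k →
                                                 cong (λ j → a i * (fromℕ F j * b j)) (ℕ.+-∸-assoc 1 (ℕ.≤-pred i<1+k))) ⟩
      (a ⋆ ∂ b) k                          ∎

  ∂ʳ-⋆ : ∀ {m n a b} → VanishesAbove m a → VanishesAbove n b →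
    ∀ k → fromℕ F (m ℕ.+ n ∸ k) * (a ⋆ b) k ≡ (∂ʳ m a ⋆ b) k + (a ⋆ ∂ʳ n b) k
  ∂ʳ-⋆ {m} {n} {a} {b} a-vanishes b-vanishes k =
    trans (sum<-*ˡ (suc k) _ _) (trans (sum<-cong (suc k) (λ i i<1+k → split i (ℕ.≤-pred i<1+k))) (sum<-+ (suc k) _ _))
    where
    zero-factorˡ : ∀ p q r y → p * (0# * y) ≡ (q * 0#) * y + 0# * (r * y)
    zero-factorˡ = solve 4 (λ p q r y → p :* (con (+ℤ 0) :* y) := (q :* con (+ℤ 0)) :* y :+ con (+ℤ 0) :* (r :* y)) refl
    zero-factorʳ : ∀ p q r x → p * (x * 0#) ≡ (q * x) * 0# + x * (r * 0#)
    zero-factorʳ = solve 4 (λ p q r x → p :* (x :* con (+ℤ 0)) := (q :* x) :* con (+ℤ 0) :+ x :* (r :* con (+ℤ 0))) refl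
    split : ∀ i → i ℕ.≤ k → fromℕ F (m ℕ.+ n ∸ k) * (a i * b (k ∸ i))
                          ≡ ∂ʳ m a i * b (k ∸ i) + a i * ∂ʳ n b (k ∸ i)
    split i i≤k with i ℕ.≤? m | k ∸ i ℕ.≤? n
    ... | yes i≤m | yes k∸i≤n = trans (cong (λ j → fromℕ F j * (a i * b (k ∸ i))) (m+n∸k≡[m∸i]+[n∸[k∸i]] i≤k i≤m k∸i≤n))
      (fromℕ-+-*-split (m ∸ i) (n ∸ (k ∸ i)) (a i) (b (k ∸ i)))
    ... | no i≰m | _ rewrite a-vanishes i (ℕ.≰⇒> i≰m) = zero-factorˡ _ _ _ _
    ... | yes _ | no k∸i≰n rewrite b-vanishes (k ∸ i) (ℕ.≰⇒> k∸i≰n) = zero-factorʳ _ _ _ _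

  Δ : ℕ → (ℕ → Carrier) → ℕ → Carrier
  Δ m s = weighted m (λ i → s (suc i) - s i)

  ∂-weighted : ∀ m s i → ∂ (weighted m s) i ≡ ∂ʳ m (weighted m s) i + fromℕ F m * Δ (m ∸ 1) s i
  ∂-weighted zero s i rewrite ℕ.0∸n≡0 i =
    solve 4 (λ x a b c → x :* (con (+ℤ 0) :* a) := con (+ℤ 0) :* b :+ con (+ℤ 0) :* c) refl _ _ _ _
  ∂-weighted (suc m) s i = begin
    fromℕ F (suc i) * (fromℕ F (suc m C suc i) * s (suc i))
      ≡⟨ fromℕ-*-assoc (suc i) (suc m C suc i) _ ⟩
    fromℕ F (suc i ℕ.* (suc m C suc i)) * s (suc i)
      ≡⟨ cong (λ c → fromℕ F c * s (suc i)) ([k+1]*[n+1]C[k+1]≡[n+1]*nCk m i) ⟩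
    fromℕ F (suc m ℕ.* (m C i)) * s (suc i)
      ≡⟨ cong (_* s (suc i)) (fromℕ-* (suc m) (m C i)) ⟩
    (fromℕ F (suc m) * fromℕ F (m C i)) * s (suc i)
      ≡⟨ solve 4 (λ c d x y → (c :* d) :* y := (c :* d) :* x :+ c :* (d :* (y :- x))) refl
           (fromℕ F (suc m)) (fromℕ F (m C i)) (s i) (s (suc i)) ⟩
    (fromℕ F (suc m) * fromℕ F (m C i)) * s i + fromℕ F (suc m) * Δ m s i
      ≡⟨ cong (λ c → c * s i + fromℕ F (suc m) * Δ m s i) (sym (fromℕ-* (suc m) (m C i))) ⟩
    fromℕ F (suc m ℕ.* (m C i)) * s i + fromℕ F (suc m) * Δ m s i
      ≡⟨ cong (λ c → fromℕ F c * s i + fromℕ F (suc m) * Δ m s i) (sym ([n+1∸k]*[n+1]Ck≡[n+1]*nCk m i)) ⟩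
    fromℕ F ((suc m ∸ i) ℕ.* (suc m C i)) * s i + fromℕ F (suc m) * Δ m s i
      ≡⟨ cong (_+ fromℕ F (suc m) * Δ m s i) (sym (fromℕ-*-assoc (suc m ∸ i) (suc m C i) _)) ⟩
    fromℕ F (suc m ∸ i) * (fromℕ F (suc m C i) * s i) + fromℕ F (suc m) * Δ m s i ∎
    where open ≡-Reasoning

  ∂-weighted-⋆ : ∀ m s b k → (∂ (weighted m s) ⋆ b) k ≡ (∂ʳ m (weighted m s) ⋆ b) k + fromℕ F m * (Δ (m ∸ 1) s ⋆ b) k
  ∂-weighted-⋆ m s b k = trans (⋆-cong {b = b} (∂-weighted m s) (λ _ → refl) k)
    (trans (⋆-+ˡ _ _ b k) (cong ((∂ʳ m (weighted m s) ⋆ b) k +_) (⋆-*ˡ _ _ b k)))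

  reverseUpTo : ℕ → (ℕ → Carrier) → ℕ → Carrier
  reverseUpTo k b i with i ℕ.≤? k
  ... | yes _ = b (k ∸ i)
  ... | no _ = 0#

  reverseUpTo-≤ : ∀ {k} b {i} → i ℕ.≤ k → reverseUpTo k b i ≡ b (k ∸ i)
  reverseUpTo-≤ {k} b {i} i≤k with i ℕ.≤? k
  ... | yes _ = refl
  ... | no i≰k = contradiction i≤k i≰k

  reverseUpTo-> : ∀ {k} b {i} → k ℕ.< i → reverseUpTo k b i ≡ 0#
  reverseUpTo-> {k} b {i} k<i with i ℕ.≤? k
  ... | yes i≤k = contradiction i≤k (ℕ.<⇒≱ k<i)
  ... | no _ = refl

  reverseUpTo-nonneg : ∀ {k b} → Nonneg b → Nonneg (reverseUpTo k b)
  reverseUpTo-nonneg {k} 0≤b i with i ℕ.≤? k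
  ... | yes _ = 0≤b (k ∸ i)
  ... | no _ = ≤-refl

  -- Pairing i with m ∸ i, the differences of α have opposite signs and reverseUpTo k b decreases.
  ⋆-Δ-nonneg : ∀ {m n α b} → Symmetric (suc m) α → RisesToMiddle (suc m) α →
    Nonneg b → Symmetric n b → RisesToMiddle n b →
    ∀ {k} → suc (k ℕ.+ k) ℕ.≤ suc m ℕ.+ n → 0# ≤ (Δ m α ⋆ b) k
  ⋆-Δ-nonneg {m} {n} {α} {b} sym-α rises-α 0≤b sym-b rises-b {k} 1+k+k≤1+m+n =
    subst (0# ≤_) (sym ⋆≡sum) (sum<-pairs-nonneg m pair)
    where
    B = reverseUpTo k b
    g : ℕ → Carrier
    g i = Δ m α i * B i
    g-beyond-k : ∀ j → g (suc k ℕ.+ j) ≡ 0#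
    g-beyond-k j = trans (cong (Δ m α (suc k ℕ.+ j) *_) (reverseUpTo-> b (s≤s (ℕ.m≤m+n k j)))) (zeroʳ _)
    g-beyond-m : ∀ j → g (suc m ℕ.+ j) ≡ 0#
    g-beyond-m j = trans (cong (_* B (suc m ℕ.+ j))
      (weighted-vanishes m (λ i → α (suc i) - α i) _ (s≤s (ℕ.m≤m+n m j)))) (zeroˡ _)
    ⋆≡sum : (Δ m α ⋆ b) k ≡ sum< (suc m) g
    ⋆≡sum = begin
      (Δ m α ⋆ b) k         ≡⟨ sum<-cong (suc k) (λ i i<1+k → cong (Δ m α i *_) (sym (reverseUpTo-≤ b (ℕ.≤-pred i<1+k)))) ⟩
      sum< (suc k) g        ≡⟨ sum<-extend (suc k) m (λ j _ → g-beyond-k j) ⟨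
      sum< (suc k ℕ.+ m) g  ≡⟨ cong (λ l → sum< (suc l) g) (ℕ.+-comm k m) ⟩
      sum< (suc m ℕ.+ k) g  ≡⟨ sum<-extend (suc m) k (λ j _ → g-beyond-m j) ⟩
      sum< (suc m) g        ∎
      where open ≡-Reasoning
    pair : ∀ i → i ℕ.+ i ℕ.≤ m → 0# ≤ g i + g (m ∸ i)
    pair i i+i≤m = subst (0# ≤_) (sym pair≡)
      (*-nonneg _ _ (*-nonneg _ _ (0≤fromℕ (m C i)) (x≤y⇒0≤y-x (rises-α i (s≤s i+i≤m)))) (x≤y⇒0≤y-x B[m∸i]≤B[i]))
      where
      i≤m = ℕ.m+n≤o⇒m≤o i i+i≤m
      i≤m∸i = ℕ.m+n≤o⇒m≤o∸n i i+i≤m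
      pair≡ : g i + g (m ∸ i) ≡ (fromℕ F (m C i) * (α (suc i) - α i)) * (B i - B (m ∸ i))
      pair≡ with symmetric-mirror sym-α (s≤s i≤m)
      ... | α[1+i]≡α[m∸i] , α[i]≡α[1+m∸i] rewrite sym (nCk≡nC[n∸k] i≤m) | sym α[1+i]≡α[m∸i] | sym α[i]≡α[1+m∸i] =
        solve 5 (λ c x y u v → c :* (y :- x) :* u :+ c :* (x :- y) :* v := (c :* (y :- x)) :* (u :- v)) refl
          (fromℕ F (m C i)) (α i) (α (suc i)) (B i) (B (m ∸ i))
      B[m∸i]≤B[i] : B (m ∸ i) ≤ B i
      B[m∸i]≤B[i] = compare ((m ∸ i) ℕ.≤? k)
        where
        compare : Dec (m ∸ i ℕ.≤ k) → B (m ∸ i) ≤ B i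
        compare (yes m∸i≤k) = subst₂ _≤_ (sym (reverseUpTo-≤ b m∸i≤k)) (sym (reverseUpTo-≤ b i≤k))
          (symmetric∧risesToMiddle⇒≤ sym-b rises-b (ℕ.∸-monoʳ-≤ k i≤m∸i)
            ([k∸[m∸i]]+[k∸i]≤n i≤m m∸i≤k i≤k (ℕ.≤-pred 1+k+k≤1+m+n)))
          where i≤k = ℕ.≤-trans i≤m∸i m∸i≤k
        compare (no m∸i≰k) = subst (_≤ B i) (sym (reverseUpTo-> b (ℕ.≰⇒> m∸i≰k))) (reverseUpTo-nonneg 0≤b i)

  fromℕ-*-⋆-Δ-nonneg : ∀ m {n α b} → Symmetric m α → RisesToMiddle m α →
    Nonneg b → Symmetric n b → RisesToMiddle n b →
    ∀ {k} → suc (k ℕ.+ k) ℕ.≤ m ℕ.+ n → 0# ≤ fromℕ F m * (Δ (m ∸ 1) α ⋆ b) k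
  fromℕ-*-⋆-Δ-nonneg zero _ _ _ _ _ _ = subst (0# ≤_) (sym (zeroˡ _)) ≤-refl
  fromℕ-*-⋆-Δ-nonneg (suc m) sym-α rises-α 0≤b sym-b rises-b 1+k+k≤1+m+n =
    *-nonneg _ _ (0≤fromℕ (suc m)) (⋆-Δ-nonneg sym-α rises-α 0≤b sym-b rises-b 1+k+k≤1+m+n)

  weighted-⋆-ratio : ∀ {m n α β} → Nonneg α → Symmetric m α → RisesToMiddle m α →
    Nonneg β → Symmetric n β → RisesToMiddle n β →
    ∀ k → suc (k ℕ.+ k) ℕ.≤ m ℕ.+ n →
    fromℕ F (m ℕ.+ n ∸ k) * (weighted m α ⋆ weighted n β) k ≤ fromℕ F (suc k) * (weighted m α ⋆ weighted n β) (suc k)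
  weighted-⋆-ratio {m} {n} {α} {β} 0≤α sym-α rises-α 0≤β sym-β rises-β k 1+k+k≤m+n =
    subst₂ _≤_ (sym lower≡) (sym upper≡) (+-mono-≤ (x≤x+y P-nonneg) (x≤x+y Q-nonneg))
    where
    a = weighted m α
    b = weighted n β
    X = (∂ʳ m a ⋆ b) k
    Y = (a ⋆ ∂ʳ n b) k
    P = fromℕ F m * (Δ (m ∸ 1) α ⋆ b) k
    Q = fromℕ F n * (Δ (n ∸ 1) β ⋆ a) k
    lower≡ : fromℕ F (m ℕ.+ n ∸ k) * (a ⋆ b) k ≡ X + Y
    lower≡ = ∂ʳ-⋆ (weighted-vanishes m α) (weighted-vanishes n β) k
    upper≡ : fromℕ F (suc k) * (a ⋆ b) (suc k) ≡ (X + P) + (Y + Q)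
    upper≡ = begin
      fromℕ F (suc k) * (a ⋆ b) (suc k)   ≡⟨ ∂-⋆ a b k ⟩
      (∂ a ⋆ b) k + (a ⋆ ∂ b) k           ≡⟨ cong ((∂ a ⋆ b) k +_) (⋆-comm a (∂ b) k) ⟩
      (∂ a ⋆ b) k + (∂ b ⋆ a) k           ≡⟨ cong₂ _+_ (∂-weighted-⋆ m α b k) (∂-weighted-⋆ n β a k) ⟩
      (X + P) + ((∂ʳ n b ⋆ a) k + Q)      ≡⟨ cong (λ z → (X + P) + (z + Q)) (⋆-comm (∂ʳ n b) a k) ⟩
      (X + P) + (Y + Q)                   ∎
      where open ≡-Reasoning
    P-nonneg : 0# ≤ P
    P-nonneg = fromℕ-*-⋆-Δ-nonneg m sym-α rises-α (weighted-nonneg 0≤β) (weighted-symmetric sym-β)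
      (weighted-risesToMiddle 0≤β rises-β) 1+k+k≤m+n
    Q-nonneg : 0# ≤ Q
    Q-nonneg = fromℕ-*-⋆-Δ-nonneg n sym-β rises-β (weighted-nonneg 0≤α) (weighted-symmetric sym-α)
      (weighted-risesToMiddle 0≤α rises-α) (subst (suc (k ℕ.+ k) ℕ.≤_) (ℕ.+-comm m n) 1+k+k≤m+n)

module AntipodalMass (F : OrderedField) where

  open OrderedFieldProperties F
  open FiniteSums F
  open Sequences F
  open Convolution F

  antipodal : ∀ {n} → Measure F n → ℕ → Carrier
  antipodal {n} ρ i = sumL F (λ η → ρ η * ρ (flipAll η)) (filter (λ η → weight η ℕ.≟ i) (allVecs n))

  antipodal-indicator : ∀ {n} (ρ : Measure F n) i →
    antipodal ρ i ≡ sumL F (λ η → when (weight η ℕ.≟ i) (ρ η * ρ (flipAll η))) (allVecs n)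
  antipodal-indicator {n} ρ i = sumL-filter (λ η → weight η ℕ.≟ i) _ (allVecs n)

  antipodal-symmetric : ∀ {n} (ρ : Measure F n) → Symmetric n (antipodal ρ)
  antipodal-symmetric {n} ρ i i≤n = begin
    antipodal ρ i
      ≡⟨ antipodal-indicator ρ i ⟩
    sumL F (λ η → when (weight η ℕ.≟ i) (ρ η * ρ (flipAll η))) (allVecs n)
      ≡⟨ sumL-allVecs-flipAll n _ ⟩
    sumL F (λ η → when (weight (flipAll η) ℕ.≟ i) (ρ (flipAll η) * ρ (flipAll (flipAll η)))) (allVecs n)
      ≡⟨ sumL-cong (allVecs n) flipped ⟩
    sumL F (λ η → when (weight η ℕ.≟ n ∸ i) (ρ η * ρ (flipAll η))) (allVecs n)
      ≡⟨ antipodal-indicator ρ (n ∸ i) ⟨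
    antipodal ρ (n ∸ i) ∎
    where
    open ≡-Reasoning
    flipped : ∀ η → when (weight (flipAll η) ℕ.≟ i) (ρ (flipAll η) * ρ (flipAll (flipAll η)))
                  ≡ when (weight η ℕ.≟ n ∸ i) (ρ η * ρ (flipAll η))
    flipped η rewrite flipAll-involutive η | weight-flipAll η =
      trans (cong (when (n ∸ weight η ℕ.≟ i)) (*-comm _ _)) (when-cong (n ∸ weight η ℕ.≟ i) (weight η ℕ.≟ n ∸ i) _
        (λ n∸w≡i → trans (sym (ℕ.m∸[m∸n]≡n (weight≤length η))) (cong (n ∸_) n∸w≡i))
        (λ w≡n∸i → trans (cong (n ∸_) w≡n∸i) (ℕ.m∸[m∸n]≡n i≤n)))

  antipodal-vanishes : ∀ {n} (ρ : Measure F n) → VanishesAbove n (antipodal ρ)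
  antipodal-vanishes {n} ρ i n<i = trans (antipodal-indicator ρ i) (sumL-zero (allVecs n))
    where
    term≡0 : ∀ η → when (weight η ℕ.≟ i) (ρ η * ρ (flipAll η)) ≡ 0#
    term≡0 η with weight η ℕ.≟ i
    ... | yes refl = contradiction (weight≤length η) (ℕ.<⇒≱ n<i)
    ... | no _ = refl
    sumL-zero : ∀ ηs → sumL F (λ η → when (weight η ℕ.≟ i) (ρ η * ρ (flipAll η))) ηs ≡ 0#
    sumL-zero [] = refl
    sumL-zero (η ∷ ηs) = trans (cong₂ _+_ (term≡0 η) (sumL-zero ηs)) (+-identityˡ 0#)

  antipodal-nonneg : ∀ {n} {ρ : Measure F n} → (∀ η → 0# ≤ ρ η) → Nonneg (antipodal ρ)
  antipodal-nonneg {n} {ρ} 0≤ρ i = subst (0# ≤_) (sym (antipodal-indicator ρ i))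
    (sumL-nonneg (allVecs n) (λ η → when-nonneg (weight η ℕ.≟ i) (*-nonneg _ _ (0≤ρ η) (0≤ρ (flipAll η)))))

  γ-symmetric : ∀ {n} (ρ : Measure F n) → Symmetric n (γ F ρ)
  γ-symmetric ρ = normalized-symmetric (antipodal-symmetric ρ)

  γ-nonneg : ∀ {n} {ρ : Measure F n} → (∀ η → 0# ≤ ρ η) → Nonneg (γ F ρ)
  γ-nonneg {n} {ρ} 0≤ρ i with i ℕ.≤? n
  ... | yes i≤n = *-nonneg _ _ (0<x⇒0≤x⁻¹ (0≤fromℕ (n C i) , λ 0≡c → 0<n⇒fromℕ≢0 (k≤n⇒0<nCk i≤n) (sym 0≡c)))
                    (antipodal-nonneg 0≤ρ i)
  ... | no i≰n = subst (0# ≤_) (sym (trans (cong (_ *_) (antipodal-vanishes ρ i (ℕ.≰⇒> i≰n))) (zeroʳ _))) ≤-refl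

  antipodal≡weighted-γ : ∀ {n} (ρ : Measure F n) i → antipodal ρ i ≡ weighted n (γ F ρ) i
  antipodal≡weighted-γ {n} ρ i with i ℕ.≤? n
  ... | yes i≤n = sym (begin
    c * (c ⁻¹ * antipodal ρ i)   ≡⟨ *-assoc _ _ _ ⟨
    (c * c ⁻¹) * antipodal ρ i   ≡⟨ cong (_* antipodal ρ i) (⁻¹-inverse c (0<n⇒fromℕ≢0 (k≤n⇒0<nCk i≤n))) ⟩
    1# * antipodal ρ i           ≡⟨ *-identityˡ _ ⟩
    antipodal ρ i                ∎)
    where
    open ≡-Reasoning
    c = fromℕ F (n C i)
  ... | no i≰n = trans (antipodal-vanishes ρ i (ℕ.≰⇒> i≰n)) (sym (weighted-vanishes n (γ F ρ) i (ℕ.≰⇒> i≰n)))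

  -- join is a weight- and flip-preserving bijection {0,1}^m × {0,1}^n → {0,1}^N, bijectivity being stated through sums
  record Splitting (N m n : ℕ) : Set where
    field
      join : Vec Bool m → Vec Bool n → Vec Bool N
      weight-join : ∀ ξ η → weight (join ξ η) ≡ weight ξ ℕ.+ weight η
      flipAll-join : ∀ ξ η → flipAll (join ξ η) ≡ join (flipAll ξ) (flipAll η)
      sumL-join : ∀ (f : Vec Bool N → Carrier) →
        sumL F f (allVecs N) ≡ sumL F (λ ξ → sumL F (λ η → f (join ξ η)) (allVecs n)) (allVecs m)

  antipodal-split : ∀ {N m n} (S : Splitting N m n) {ρ : Measure F N} {μ : Measure F m} {ν : Measure F n} →
    (∀ ξ η → ρ (Splitting.join S ξ η) ≡ μ ξ * ν η) → ∀ k → antipodal ρ k ≡ (antipodal μ ⋆ antipodal ν) k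
  antipodal-split {N} {m} {n} S {ρ} {μ} {ν} ρ≡μν k = begin
    antipodal ρ k
      ≡⟨ antipodal-indicator ρ k ⟩
    sumL F (A ρ k) (allVecs N)
      ≡⟨ sumL-join _ ⟩
    sumL F (λ ξ → sumL F (λ η → A ρ k (join ξ η)) (allVecs n)) (allVecs m)
      ≡⟨ sumL-cong (allVecs m) (λ ξ → sumL-cong (allVecs n) (λ η → term ξ η)) ⟩
    sumL F (λ ξ → sumL F (λ η → ∑[ i < suc k ] (A μ i ξ * A ν (k ∸ i) η)) (allVecs n)) (allVecs m)
      ≡⟨ sumL-cong (allVecs m) (λ ξ → sumL-sum< (suc k) _ (allVecs n)) ⟨
    sumL F (λ ξ → ∑[ i < suc k ] sumL F (λ η → A μ i ξ * A ν (k ∸ i) η) (allVecs n)) (allVecs m)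
      ≡⟨ sumL-sum< (suc k) _ (allVecs m) ⟨
    ∑[ i < suc k ] sumL F (λ ξ → sumL F (λ η → A μ i ξ * A ν (k ∸ i) η) (allVecs n)) (allVecs m)
      ≡⟨ sum<-cong (suc k) (λ i _ → sumL-product (A μ i) (A ν (k ∸ i)) (allVecs m) (allVecs n)) ⟨
    ∑[ i < suc k ] (sumL F (A μ i) (allVecs m) * sumL F (A ν (k ∸ i)) (allVecs n))
      ≡⟨ ⋆-cong (λ i → sym (antipodal-indicator μ i)) (λ j → sym (antipodal-indicator ν j)) k ⟩
    (antipodal μ ⋆ antipodal ν) k ∎
    where
    open ≡-Reasoning
    open Splitting S
    A : ∀ {l} → Measure F l → ℕ → Vec Bool l → Carrier
    A σ i η = when (weight η ℕ.≟ i) (σ η * σ (flipAll η))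
    term : ∀ ξ η → A ρ k (join ξ η) ≡ ∑[ i < suc k ] (A μ i ξ * A ν (k ∸ i) η)
    term ξ η = begin
      when (weight (join ξ η) ℕ.≟ k) (ρ (join ξ η) * ρ (flipAll (join ξ η)))
        ≡⟨ cong (λ ζ → when (weight (join ξ η) ℕ.≟ k) (ρ (join ξ η) * ρ ζ)) (flipAll-join ξ η) ⟩
      when (weight (join ξ η) ℕ.≟ k) (ρ (join ξ η) * ρ (join (flipAll ξ) (flipAll η)))
        ≡⟨ cong (when (weight (join ξ η) ℕ.≟ k)) (cong₂ _*_ (ρ≡μν ξ η) (ρ≡μν (flipAll ξ) (flipAll η))) ⟩
      when (weight (join ξ η) ℕ.≟ k) ((μ ξ * ν η) * (μ (flipAll ξ) * ν (flipAll η)))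
        ≡⟨ when-cong (weight (join ξ η) ℕ.≟ k) (weight ξ ℕ.+ weight η ℕ.≟ k) _
             (trans (sym (weight-join ξ η))) (trans (weight-join ξ η)) ⟩
      when (weight ξ ℕ.+ weight η ℕ.≟ k) ((μ ξ * ν η) * (μ (flipAll ξ) * ν (flipAll η)))
        ≡⟨ cong (when (weight ξ ℕ.+ weight η ℕ.≟ k))
             (solve 4 (λ a b a' b' → (a :* b) :* (a' :* b') := (a :* a') :* (b :* b')) refl _ _ _ _) ⟩
      when (weight ξ ℕ.+ weight η ℕ.≟ k) ((μ ξ * μ (flipAll ξ)) * (ν η * ν (flipAll η)))
        ≡⟨ indicator-⋆ (weight ξ) (weight η) k _ _ ⟨
      ∑[ i < suc k ] (A μ i ξ * A ν (k ∸ i) η) ∎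

  splitting-APU : ∀ {N m n} (S : Splitting N m n) → N ≡ m ℕ.+ n →
    ∀ {ρ : Measure F N} {μ : Measure F m} {ν : Measure F n} → (∀ ξ η → ρ (Splitting.join S ξ η) ≡ μ ξ * ν η) →
    (∀ ξ → 0# ≤ μ ξ) → (∀ η → 0# ≤ ν η) → APU F μ → APU F ν → APU F ρ
  splitting-APU {m = m} {n} S refl {ρ} {μ} {ν} ρ≡μν 0≤μ 0≤ν apu-μ apu-ν =
    symmetric∧risesToMiddle⇒unimodal (γ-symmetric ρ) (normalized-risesToMiddle ratio)
    where
    antipodal≡⋆ : ∀ k → antipodal ρ k ≡ (weighted m (γ F μ) ⋆ weighted n (γ F ν)) k
    antipodal≡⋆ k = trans (antipodal-split S ρ≡μν k) (⋆-cong (antipodal≡weighted-γ μ) (antipodal≡weighted-γ ν) k)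
    ratio : ∀ k → suc (k ℕ.+ k) ℕ.≤ m ℕ.+ n → fromℕ F (m ℕ.+ n ∸ k) * antipodal ρ k ≤ fromℕ F (suc k) * antipodal ρ (suc k)
    ratio k 1+k+k≤m+n = subst₂ _≤_ (cong (_ *_) (sym (antipodal≡⋆ k))) (cong (_ *_) (sym (antipodal≡⋆ (suc k))))
      (weighted-⋆-ratio (γ-nonneg 0≤μ) (γ-symmetric μ) (unimodal∧symmetric⇒risesToMiddle apu-μ (γ-symmetric μ))
                        (γ-nonneg 0≤ν) (γ-symmetric ν) (unimodal∧symmetric⇒risesToMiddle apu-ν (γ-symmetric ν))
                        k 1+k+k≤m+n)

module ProductMeasure (F : OrderedField) where

  open OrderedFieldProperties F
  open FiniteSums F
  open AntipodalMass F

  sumL-allVecs-++ : ∀ m n (f : Vec Bool (m ℕ.+ n) → Carrier) →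
    sumL F f (allVecs (m ℕ.+ n)) ≡ sumL F (λ ξ → sumL F (λ η → f (ξ ++ η)) (allVecs n)) (allVecs m)
  sumL-allVecs-++ zero n f = sym (+-identityʳ _)
  sumL-allVecs-++ (suc m) n f = begin
    sumL F f (allVecs (suc m ℕ.+ n))
      ≡⟨ sumL-allVecs-suc f ⟩
    sumL F (λ ζ → f (true ∷ ζ)) (allVecs (m ℕ.+ n)) + sumL F (λ ζ → f (false ∷ ζ)) (allVecs (m ℕ.+ n))
      ≡⟨ cong₂ _+_ (sumL-allVecs-++ m n _) (sumL-allVecs-++ m n _) ⟩
    sumL F (λ ξ → g (true ∷ ξ)) (allVecs m) + sumL F (λ ξ → g (false ∷ ξ)) (allVecs m)
      ≡⟨ sumL-allVecs-suc g ⟨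
    sumL F g (allVecs (suc m)) ∎
    where
    open ≡-Reasoning
    g : Vec Bool (suc m) → Carrier
    g ξ = sumL F (λ η → f (ξ ++ η)) (allVecs n)

  sumL-allVecs-joinFree : ∀ m {n} (p : Vec (Maybe Bool) (m ℕ.+ n)) (f : Vec Bool (free p) → Carrier) →
    sumL F f (allVecs (free p))
      ≡ sumL F (λ ξ → sumL F (λ η → f (joinFree m p ξ η)) (allVecs (free (drop m p)))) (allVecs (free (take m p)))
  sumL-allVecs-joinFree zero p f = sym (+-identityʳ _)
  sumL-allVecs-joinFree (suc m) (just b ∷ p) f = sumL-allVecs-joinFree m p f
  sumL-allVecs-joinFree (suc m) (nothing ∷ p) f = begin
    sumL F f (allVecs (suc (free p)))
      ≡⟨ sumL-allVecs-suc f ⟩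
    sumL F (λ ζ → f (true ∷ ζ)) (allVecs (free p)) + sumL F (λ ζ → f (false ∷ ζ)) (allVecs (free p))
      ≡⟨ cong₂ _+_ (sumL-allVecs-joinFree m p _) (sumL-allVecs-joinFree m p _) ⟩
    sumL F (λ ξ → g (true ∷ ξ)) (allVecs (free (take m p))) + sumL F (λ ξ → g (false ∷ ξ)) (allVecs (free (take m p)))
      ≡⟨ sumL-allVecs-suc g ⟨
    sumL F g (allVecs (suc (free (take m p)))) ∎
    where
    open ≡-Reasoning
    g : Vec Bool (suc (free (take m p))) → Carrier
    g ξ = sumL F (λ η → f (joinFree (suc m) (nothing ∷ p) ξ η)) (allVecs (free (drop m p)))

  ++-splitting : ∀ m n → Splitting (m ℕ.+ n) m n
  ++-splitting m n = record
    { join = _++_ ; weight-join = weight-++ ; flipAll-join = map-++ not ; sumL-join = sumL-allVecs-++ m n }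

  joinFree-splitting : ∀ m {n} (p : Vec (Maybe Bool) (m ℕ.+ n)) → Splitting (free p) (free (take m p)) (free (drop m p))
  joinFree-splitting m p = record
    { join = joinFree m p ; weight-join = weight-joinFree m p
    ; flipAll-join = flipAll-joinFree m p ; sumL-join = sumL-allVecs-joinFree m p }

  module _ {m n} (μ : Measure F m) (ν : Measure F n) (p : Vec (Maybe Bool) (m ℕ.+ n)) where

    ⊗-fill-joinFree : ∀ ξ η → _⊗_ F μ ν (fill p (joinFree m p ξ η)) ≡ μ (fill (take m p) ξ) * ν (fill (drop m p) η)
    ⊗-fill-joinFree ξ η = cong₂ _*_ (cong μ (take-fill-joinFree m p ξ η)) (cong ν (drop-fill-joinFree m p ξ η))

    pinnedMass-⊗ : pinnedMass F (_⊗_ F μ ν) p ≡ pinnedMass F μ (take m p) * pinnedMass F ν (drop m p)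
    pinnedMass-⊗ = trans (sumL-allVecs-joinFree m p _)
      (trans (sumL-cong (allVecs (free (take m p))) (λ ξ → sumL-cong (allVecs (free (drop m p))) (⊗-fill-joinFree ξ)))
        (sym (sumL-product (λ ξ → μ (fill (take m p) ξ)) (λ η → ν (fill (drop m p) η))
          (allVecs (free (take m p))) (allVecs (free (drop m p))))))

    condition-⊗ : pinnedMass F μ (take m p) ≢ 0# → pinnedMass F ν (drop m p) ≢ 0# →
      ∀ ξ η → condition F (_⊗_ F μ ν) p (joinFree m p ξ η) ≡ condition F μ (take m p) ξ * condition F ν (drop m p) η
    condition-⊗ M≢0 N≢0 ξ η = begin
      _⊗_ F μ ν (fill p (joinFree m p ξ η)) * pinnedMass F (_⊗_ F μ ν) p ⁻¹
        ≡⟨ cong₂ (λ x c → x * c ⁻¹) (⊗-fill-joinFree ξ η) pinnedMass-⊗ ⟩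
      (μ (fill (take m p) ξ) * ν (fill (drop m p) η)) * (M * N) ⁻¹
        ≡⟨ cong (_ *_) (⁻¹-distrib-* M≢0 N≢0) ⟩
      (μ (fill (take m p) ξ) * ν (fill (drop m p) η)) * (M ⁻¹ * N ⁻¹)
        ≡⟨ solve 4 (λ a b c d → (a :* b) :* (c :* d) := (a :* c) :* (b :* d)) refl _ _ _ _ ⟩
      (μ (fill (take m p) ξ) * M ⁻¹) * (ν (fill (drop m p) η) * N ⁻¹) ∎
      where
      open ≡-Reasoning
      M = pinnedMass F μ (take m p)
      N = pinnedMass F ν (drop m p)

  pinnedMass-nonneg : ∀ {m} {ρ : Measure F m} → (∀ η → 0# ≤ ρ η) → ∀ p → 0# ≤ pinnedMass F ρ p
  pinnedMass-nonneg 0≤ρ p = sumL-nonneg (allVecs (free p)) (λ η → 0≤ρ (fill p η))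

  condition-nonneg : ∀ {m} {ρ : Measure F m} → (∀ η → 0# ≤ ρ η) → ∀ {p} → 0# < pinnedMass F ρ p →
    ∀ η → 0# ≤ condition F ρ p η
  condition-nonneg 0≤ρ 0<mass η = *-nonneg _ _ (0≤ρ _) (0<x⇒0≤x⁻¹ 0<mass)

  module _ {m n} {μ : Measure F m} {ν : Measure F n} (0≤μ : ∀ ξ → 0# ≤ μ ξ) (0≤ν : ∀ η → 0# ≤ ν η) where

    ⊗-APU : APU F μ → APU F ν → APU F (_⊗_ F μ ν)
    ⊗-APU = splitting-APU (++-splitting m n) refl
      (λ ξ η → cong₂ _*_ (cong μ (take-++ m ξ η)) (cong ν (drop-++ m ξ η))) 0≤μ 0≤ν

    ⊗-CAPU : CAPU F μ → CAPU F ν → CAPU F (_⊗_ F μ ν)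
    ⊗-CAPU capu-μ capu-ν p (_ , 0≢mass) =
      splitting-APU (joinFree-splitting m p) (free-take+free-drop m p) (condition-⊗ μ ν p (0≢M ∘ sym) (0≢N ∘ sym))
        (condition-nonneg 0≤μ 0<M) (condition-nonneg 0≤ν 0<N) (capu-μ (take m p) 0<M) (capu-ν (drop m p) 0<N)
      where
      M = pinnedMass F μ (take m p)
      N = pinnedMass F ν (drop m p)
      0≢M : 0# ≢ M
      0≢M 0≡M = 0≢mass (sym (trans (pinnedMass-⊗ μ ν p) (trans (cong (_* N) (sym 0≡M)) (zeroˡ N))))
      0≢N : 0# ≢ N
      0≢N 0≡N = 0≢mass (sym (trans (pinnedMass-⊗ μ ν p) (trans (cong (M *_) (sym 0≡N)) (zeroʳ M))))
      0<M : 0# < M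
      0<M = pinnedMass-nonneg 0≤μ (take m p) , 0≢M
      0<N : 0# < N
      0<N = pinnedMass-nonneg 0≤ν (drop m p) , 0≢N

open ProductMeasure using (⊗-APU; ⊗-CAPU)

theorem4p2 : (F : OrderedField) (m n : ℕ)
    (μ : Measure F m) (ν : Measure F n) →
    IsProbability F μ → IsProbability F ν →
    (APU F μ → APU F ν → APU F (_⊗_ F μ ν))
    × (CAPU F μ → CAPU F ν → CAPU F (_⊗_ F μ ν))
theorem4p2 F m n μ ν (0≤μ , _) (0≤ν , _) = ⊗-APU F 0≤μ 0≤ν , ⊗-CAPU F 0≤μ 0≤ν
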